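{- Let $p$ be an odd prime and $t\in\mathbb{N}$ with $1\le t\le p-1$. Each of the following sets $\{x_1,\dots,x_{2t}\}\subset\mathbb{Z}$ is a good starting set modulo $p$: (1) any set with $x_i\equiv \rho^{a+i-1}\pmod{p^2}$ for $1\le i\le 2t$, where $\rho\in\mathbb{Z}$ is a primitive root modulo $p^2$ and $a\in\mathbb{Z}$ (in particular $x_i\equiv\rho^{i-1}\pmod{p^2}$); (2) any set with $x_i\equiv x_{t+i}\equiv \rho^{a+i-1}\pmod p$ and $x_{t+i}\not\equiv x_i\pmod{p^2}$ for $1\le i\le t$, where $\rho\in\mathbb{Z}$ is a primitive root modulo $p$ and $a\in\mathbb{Z}$ (in particular $x_i\equiv\rho^{i-1}\pmod p$ and $x_{t+i}=x_i+p$).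
   Context: For an odd prime $p$, $e_2:\mathbb{Z}\to\mathbb{Z}/p\mathbb{Z}$ is defined by $x^{p-1}\equiv 1+p\,e_2(x)\pmod{p^2}$ if $p\nmid x$ and $e_2(x)=0$ if $p\mid x$. A set $\{x_1,\dots,x_{2t}\}\subset\mathbb{Z}$ (with $1\le t\le p-1$) is a good starting set modulo $p$ if for every subset $\{\alpha_1,\dots,\alpha_t\}\subseteq\{0,\dots,p-2\}$ of $t$ distinct elements, $$\det\begin{pmatrix} x_1^{\alpha_1}&\cdots&x_1^{\alpha_t}& e_2(x_1)x_1^{\alpha_1}&\cdots& e_2(x_1)x_1^{\alpha_t}\\ \vdots&&\vdots&\vdots&&\vdots\\ x_{2t}^{\alpha_1}&\cdots&x_{2t}^{\alpha_t}& e_2(x_{2t})x_{2t}^{\alpha_1}&\cdots& e_2(x_{2t})x_{2t}^{\alpha_t}\end{pmatrix}\not\equiv 0\pmod p.$$ -}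

module Defs where

open import Data.Nat as ℕ using (ℕ; zero; suc; NonZero; nonTrivial⇒nonZero)
open import Data.Nat.Primality using (Prime; prime)
open import Data.Nat.Divisibility using (_∣?_)
open import Data.Nat.GCD using (gcd)
open import Data.Integer using (ℤ; +_; -[1+_]; _+_; _-_; _*_; _^_; ∣_∣; 0ℤ; 1ℤ; -1ℤ)
open import Data.Integer.DivMod using (_/ℕ_)
open import Data.Integer.Divisibility using (_∣_)
open import Data.Fin using (Fin; zero; suc; toℕ; punchIn; splitAt)
open import Data.Sum using ([_,_]′)
open import Data.Product using (_×_)
open import Relation.Nullary using (¬_; yes; no)
open import Relation.Binary.PropositionalEquality using (_≡_)
open import Function.Definitions using (Injective)

_≡_[mod_] : ℤ → ℤ → ℕ → Set
x ≡ y [mod m ] = (+ m) ∣ (x - y)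

∑ : ∀ n → (Fin n → ℤ) → ℤ
∑ zero    f = 0ℤ
∑ (suc n) f = f zero + ∑ n (λ i → f (suc i))

det : ∀ n → (Fin n → Fin n → ℤ) → ℤ
det zero    M = 1ℤ
det (suc n) M =
  ∑ (suc n) (λ j → (-1ℤ ^ toℕ j) * M zero j * det n (λ r c → M (suc r) (punchIn j c)))

-- the Fermat quotient e₂ modulo the prime p (an integer representative of its class mod p):
-- e₂(x) = (x^(p-1) - 1)/p if p ∤ x, and 0 if p ∣ x
e₂ : (p : ℕ) → Prime p → ℤ → ℤ
e₂ p (prime ⦃ nt ⦄ _) x with p ∣? ∣ x ∣
... | yes _ = 0ℤ
... | no  _ = _/ℕ_ ((x ^ (p ℕ.∸ 1)) - 1ℤ) p {{nonTrivial⇒nonZero p {{nt}}}}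

goodMatrix : (p : ℕ) → Prime p → (t : ℕ) → (Fin (t ℕ.+ t) → ℤ) → (Fin t → ℕ)
           → Fin (t ℕ.+ t) → Fin (t ℕ.+ t) → ℤ
goodMatrix p pp t x α i j =
  [ (λ k → x i ^ α k) , (λ k → e₂ p pp (x i) * (x i ^ α k)) ]′ (splitAt t j)

GoodStartingSet : (p : ℕ) → Prime p → (t : ℕ) → (Fin (t ℕ.+ t) → ℤ) → Set
GoodStartingSet p pp t x =
  (α : Fin t → ℕ) → Injective _≡_ _≡_ α → (∀ k → α k ℕ.≤ p ℕ.∸ 2) →
  ¬ (det (t ℕ.+ t) (goodMatrix p pp t x α) ≡ 0ℤ [mod p ])

totCount : ℕ → ℕ → ℕ
totCount m zero = 0
totCount m (suc k) with gcd (suc k) m ℕ.≟ 1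
... | yes _ = suc (totCount m k)
... | no  _ = totCount m k

φ : ℕ → ℕ
φ m = totCount m m

PrimitiveRoot : ℕ → ℤ → Set
PrimitiveRoot m ρ =
  (gcd ∣ ρ ∣ m ≡ 1) × ((ρ ^ φ m) ≡ 1ℤ [mod m ]) ×
  (∀ k → 1 ℕ.≤ k → k ℕ.< φ m → ¬ ((ρ ^ k) ≡ 1ℤ [mod m ]))

-- x ≡ ρ^k (mod m) for an integer exponent k (for k < 0, ρ^k is the inverse of ρ^(-k) mod m)
PowCong : ℕ → ℤ → ℤ → ℤ → Set
PowCong m ρ (+ n)     x = x ≡ ρ ^ n [mod m ]
PowCong m ρ -[1+ n ]  x = (x * ρ ^ suc n) ≡ 1ℤ [mod m ]

-- Reduce modulo p and write x₀ for the first element. In both cases xᵢ ≡ x₀ ρ^(sᵢ) (mod p)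
-- for suitable positions sᵢ, so the left block has entries xᵢ^(α_k) ≡ C_k W_k^(sᵢ) with
-- C_k = x₀^(α_k) and W_k = ρ^(α_k); the W_k are distinct modulo p because ρ has order p − 1.
--
-- (1) Modulo p the Fermat quotient is a logarithm that only depends on x modulo p², so
-- e₂(xᵢ) ≡ e₂(x₀) + i e₂(ρ), and e₂(ρ) ≢ 0 because ρ is a primitive root modulo p². The right
-- block is then e₂(x₀) times the left block plus e₂(ρ) C_k W_k · i W_k^(i−1): the matrix is a
-- confluent Vandermonde matrix, and eliminating its columns node by node only multiplies its
-- determinant by units.
--
-- (2) Rows i and t + i agree in the left block. Subtracting them leaves a block anti-triangular
-- matrix with determinant ±∏ᵢ (e₂(xᵢ) − e₂(x_(t+i))) · V², where V is the Vandermonde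
-- determinant of the W_k, and e₂(xᵢ) ≢ e₂(x_(t+i)) because x_(t+i) ≡ xᵢ modulo p but not p².

module Submission where

open import Defs
open import Data.Nat using (ℕ; _≤_; _∸_) renaming (_*_ to _*ℕ_; _+_ to _+ℕ_)
open import Data.Nat.Primality using (Prime)
open import Data.Integer using (ℤ; +_; _+_)
open import Data.Fin using (Fin; toℕ; _↑ˡ_; _↑ʳ_)
open import Data.Product using (_×_)
open import Relation.Nullary using (¬_)
open import Relation.Binary.PropositionalEquality using (_≢_)

open import Data.Empty using (⊥-elim)
open import Data.Fin using (Fin; zero; suc; toℕ; punchIn; fromℕ; fromℕ<; inject₁; splitAt; _↑ˡ_; _↑ʳ_)
import Data.Fin.Properties as Finₚ
open import Data.Integer using (ℤ; +_; -[1+_]; _+_; _-_; _*_; -_; _^_; 0ℤ; 1ℤ; -1ℤ)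
import Data.Integer as ℤ using (∣_∣)
open import Data.Integer.DivMod using (_%ℕ_; _/ℕ_; a≡a%ℕn+[a/ℕn]*n; n%ℕd<d)
open import Data.Integer.Divisibility.Signed as ℤ∣ using (_∣_; divides)
import Data.Integer.Properties as ℤₚ
open import Data.Integer.Tactic.RingSolver using (solve-∀)
open import Data.Nat as ℕ using (ℕ; zero; suc; z≤n; s≤s; _<_; _≤_; _!; NonZero)
open import Data.Nat.Combinatorics using (nCn≡1; nCk≡n!/k![n-k]!; k![n∸k]!∣n!) renaming (_C_ to _choose_)
open import Data.Nat.Coprimality as Coprime using (Coprime)
open import Data.Nat.DivMod using (m/n*n≡m)
import Data.Nat.Divisibility as ℕ∣
open import Data.Nat.GCD using (gcd; gcd-greatest)
open import Data.Nat.Primality using (Prime; euclidsLemma; prime⇒irreducible; prime⇒nonTrivial; prime⇒nonZero)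
import Data.Nat.Properties as ℕₚ
open import Data.Product using (Σ-syntax; _×_; _,_; proj₁; proj₂)
open import Data.Sum using (_⊎_; inj₁; inj₂; [_,_]′)
open import Data.Sum.Properties using ([,]-map)
open import Data.Vec.Functional using (init)
open import Function using (_∘_)
open import Function.Definitions using (Injective)
open import Relation.Binary.Bundles using (Setoid)
open import Relation.Binary.Definitions using (tri<; tri≈; tri>)
open import Relation.Binary.PropositionalEquality
import Relation.Binary.Reasoning.Setoid
open import Relation.Nullary using (¬_; yes; no)
import Algebra.Properties.CommutativeSemiring.Binomial ℤₚ.+-*-commutativeSemiring as Binomial
import Algebra.Properties.CommutativeSemiring.Exp ℤₚ.+-*-commutativeSemiring as ExpProperties
open import Algebra.Properties.Semiring.Exp ℤₚ.+-*-semiring using () renaming (_^_ to _^ᴿ_)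
open import Algebra.Properties.Semiring.Mult ℤₚ.+-*-semiring using () renaming (_×_ to _×ᴿ_)
open import Algebra.Properties.Semiring.Sum ℤₚ.+-*-semiring using (sum; sum-init-last)

-- Determinants of ℕ-indexed matrices

∑ℕ : ℕ → (ℕ → ℤ) → ℤ
∑ℕ zero    f = 0ℤ
∑ℕ (suc n) f = f 0 + ∑ℕ n (λ i → f (suc i))

∑ℕ-cong : ∀ n {f g : ℕ → ℤ} → (∀ i → i < n → f i ≡ g i) → ∑ℕ n f ≡ ∑ℕ n g
∑ℕ-cong zero    f≡g = refl
∑ℕ-cong (suc n) f≡g = cong₂ _+_ (f≡g 0 (s≤s z≤n)) (∑ℕ-cong n (λ i i<n → f≡g (suc i) (s≤s i<n)))

∑ℕ-zero : ∀ n {f : ℕ → ℤ} → (∀ i → i < n → f i ≡ 0ℤ) → ∑ℕ n f ≡ 0ℤ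
∑ℕ-zero zero    f≡0 = refl
∑ℕ-zero (suc n) f≡0 =
  cong₂ _+_ (f≡0 0 (s≤s z≤n)) (∑ℕ-zero n (λ i i<n → f≡0 (suc i) (s≤s i<n)))

∑ℕ-distrib-+ : ∀ n (f g : ℕ → ℤ) → ∑ℕ n (λ i → f i + g i) ≡ ∑ℕ n f + ∑ℕ n g
∑ℕ-distrib-+ zero    f g = refl
∑ℕ-distrib-+ (suc n) f g = begin
  (f 0 + g 0) + ∑ℕ n (λ i → f (suc i) + g (suc i))
    ≡⟨ cong (_+_ (f 0 + g 0)) (∑ℕ-distrib-+ n (λ i → f (suc i)) (λ i → g (suc i))) ⟩
  (f 0 + g 0) + (∑ℕ n (λ i → f (suc i)) + ∑ℕ n (λ i → g (suc i)))
    ≡⟨ interchange (f 0) (g 0) _ _ ⟩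
  (f 0 + ∑ℕ n (λ i → f (suc i))) + (g 0 + ∑ℕ n (λ i → g (suc i))) ∎
  where
  open ≡-Reasoning
  interchange : ∀ a b c d → (a + b) + (c + d) ≡ (a + c) + (b + d)
  interchange = solve-∀

∑ℕ-*ˡ : ∀ n (c : ℤ) (f : ℕ → ℤ) → ∑ℕ n (λ i → c * f i) ≡ c * ∑ℕ n f
∑ℕ-*ˡ zero    c f = sym (ℤₚ.*-zeroʳ c)
∑ℕ-*ˡ (suc n) c f = trans (cong (_+_ (c * f 0)) (∑ℕ-*ˡ n c (λ i → f (suc i))))
                          (sym (ℤₚ.*-distribˡ-+ c (f 0) _))

∑ℕ-last : ∀ n (f : ℕ → ℤ) → ∑ℕ (suc n) f ≡ ∑ℕ n f + f n
∑ℕ-last zero    f = ℤₚ.+-comm (f 0) 0ℤ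
∑ℕ-last (suc n) f = trans (cong (_+_ (f 0)) (∑ℕ-last n (λ i → f (suc i))))
                          (sym (ℤₚ.+-assoc (f 0) _ (f (suc n))))

∑ℕ-split : ∀ m n (f : ℕ → ℤ) → ∑ℕ (m ℕ.+ n) f ≡ ∑ℕ m f + ∑ℕ n (λ i → f (m ℕ.+ i))
∑ℕ-split zero    n f = sym (ℤₚ.+-identityˡ _)
∑ℕ-split (suc m) n f = trans (cong (_+_ (f 0)) (∑ℕ-split m n (λ i → f (suc i))))
                             (sym (ℤₚ.+-assoc (f 0) _ _))

∑ℕ-single : ∀ n j {f : ℕ → ℤ} → j < n → (∀ i → i < n → i ≢ j → f i ≡ 0ℤ) → ∑ℕ n f ≡ f j
∑ℕ-single (suc n) zero {f} j<n f≡0 =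
  trans (cong (_+_ (f 0)) (∑ℕ-zero n (λ i i<n → f≡0 (suc i) (s≤s i<n) (λ ())))) (ℤₚ.+-identityʳ (f 0))
∑ℕ-single (suc n) (suc j) {f} (s≤s j<n) f≡0 =
  trans (cong (_+ ∑ℕ n (λ i → f (suc i))) (f≡0 0 (s≤s z≤n) (λ ())))
        (trans (ℤₚ.+-identityˡ _)
               (∑ℕ-single n j j<n (λ i i<n i≢j → f≡0 (suc i) (s≤s i<n) (i≢j ∘ ℕₚ.suc-injective))))

-- (j , l) ↦ (l + 1 , j) matches the terms with j ≤ l with the remaining ones.
∑ℕ-pairs : ∀ m (T : ℕ → ℕ → ℤ) → (∀ j l → j ≤ l → l < m → T j l + T (suc l) j ≡ 0ℤ) →
           ∑ℕ (suc m) (λ j → ∑ℕ m (T j)) ≡ 0ℤ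
∑ℕ-pairs zero    T cancel = ℤₚ.+-identityˡ 0ℤ
∑ℕ-pairs (suc m) T cancel = begin
  ∑ℕ (2 ℕ.+ m) (λ j → ∑ℕ (suc m) (T j))
    ≡⟨ ∑ℕ-cong (2 ℕ.+ m) (λ j _ → ∑ℕ-last m (T j)) ⟩
  ∑ℕ (2 ℕ.+ m) (λ j → ∑ℕ m (T j) + T j m)
    ≡⟨ ∑ℕ-distrib-+ (2 ℕ.+ m) (λ j → ∑ℕ m (T j)) (λ j → T j m) ⟩
  ∑ℕ (2 ℕ.+ m) (λ j → ∑ℕ m (T j)) + ∑ℕ (2 ℕ.+ m) (λ j → T j m)
    ≡⟨ cong₂ _+_ (∑ℕ-last (suc m) (λ j → ∑ℕ m (T j))) (∑ℕ-last (suc m) (λ j → T j m)) ⟩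
  (S + ∑ℕ m (T (suc m))) + (∑ℕ (suc m) (λ j → T j m) + T (suc m) m)
    ≡⟨ regroup S _ _ _ ⟩
  S + ((∑ℕ m (T (suc m)) + T (suc m) m) + ∑ℕ (suc m) (λ j → T j m))
    ≡⟨ cong (λ s → S + (s + ∑ℕ (suc m) (λ j → T j m))) (∑ℕ-last m (T (suc m))) ⟨
  S + (∑ℕ (suc m) (T (suc m)) + ∑ℕ (suc m) (λ j → T j m))
    ≡⟨ cong (_+_ S) (∑ℕ-distrib-+ (suc m) (T (suc m)) (λ j → T j m)) ⟨
  S + ∑ℕ (suc m) (λ j → T (suc m) j + T j m)
    ≡⟨ cong₂ _+_ (∑ℕ-pairs m T (λ j l j≤l l<m → cancel j l j≤l (ℕₚ.m<n⇒m<1+n l<m)))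
                 (∑ℕ-zero (suc m) (λ j j≤m → trans (ℤₚ.+-comm (T (suc m) j) (T j m))
                                                   (cancel j m (ℕₚ.≤-pred j≤m) (ℕₚ.n<1+n m)))) ⟩
  0ℤ + 0ℤ ∎
  where
  open ≡-Reasoning
  S = ∑ℕ (suc m) (λ j → ∑ℕ m (T j))
  regroup : ∀ s a b c → (s + a) + (b + c) ≡ s + ((a + c) + b)
  regroup = solve-∀

∏ℕ : ℕ → (ℕ → ℤ) → ℤ
∏ℕ zero    f = 1ℤ
∏ℕ (suc n) f = f 0 * ∏ℕ n (λ i → f (suc i))

punch : ℕ → ℕ → ℕ
punch zero    c       = suc c
punch (suc j) zero    = zero
punch (suc j) (suc c) = suc (punch j c)

punch-< : ∀ j {n c} → c < n → punch j c < suc n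
punch-< zero    c<n             = s≤s c<n
punch-< (suc j) {c = zero} _    = s≤s z≤n
punch-< (suc j) {c = suc c} (s≤s c<n) = s≤s (punch-< j c<n)

punch-below : ∀ {j c} → c < j → punch j c ≡ c
punch-below {suc j} {zero}  _         = refl
punch-below {suc j} {suc c} (s≤s c<j) = cong suc (punch-below c<j)

punch-above : ∀ {j c} → j ≤ c → punch j c ≡ suc c
punch-above {zero}              _         = refl
punch-above {suc j} {suc c} (s≤s j≤c) = cong suc (punch-above j≤c)

punch-surjective : ∀ {n j c} → j < suc n → c < suc n → j ≢ c → Σ[ c′ ∈ ℕ ] c′ < n × punch j c′ ≡ c
punch-surjective {j = zero}  {zero}  _ _ j≢c = ⊥-elim (j≢c refl)
punch-surjective {j = zero}  {suc c} _ (s≤s c<n) _ = c , c<n , refl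
punch-surjective {zero}  {suc j} (s≤s ()) _ _
punch-surjective {suc n} {suc j} {zero}  _ _ _ = zero , s≤s z≤n , refl
punch-surjective {suc n} {suc j} {suc c} (s≤s j<n) (s≤s c<n) j≢c
  with punch-surjective j<n c<n (j≢c ∘ cong suc)
... | c′ , c′<n , refl = suc c′ , s≤s c′<n , refl

punch-punch : ∀ {j l} c → j ≤ l → punch j (punch l c) ≡ punch (suc l) (punch j c)
punch-punch {zero}          c       _         = refl
punch-punch {suc j} {suc l} zero    _         = refl
punch-punch {suc j} {suc l} (suc c) (s≤s j≤l) = cong suc (punch-punch c j≤l)

punch-+ : ∀ s l c → punch (s ℕ.+ l) (s ℕ.+ c) ≡ s ℕ.+ punch l c
punch-+ zero    l c = refl
punch-+ (suc s) l c = cong suc (punch-+ s l c)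

-- detℕ n reads only the entries with both indices below n.
Matrix : Set
Matrix = ℕ → ℕ → ℤ

sgn : ℕ → ℤ
sgn n = -1ℤ ^ n

minor : ℕ → Matrix → Matrix
minor j A i c = A (suc i) (punch j c)

detℕ : ℕ → Matrix → ℤ
detℕ zero    A = 1ℤ
detℕ (suc n) A = ∑ℕ (suc n) (λ j → sgn j * A 0 j * detℕ n (minor j A))

detℕ-cong : ∀ n {A B : Matrix} → (∀ i j → i < n → j < n → A i j ≡ B i j) → detℕ n A ≡ detℕ n B
detℕ-cong zero    A≡B = refl
detℕ-cong (suc n) A≡B = ∑ℕ-cong (suc n) λ j j<n →
  cong₂ (λ a d → sgn j * a * d) (A≡B 0 j (s≤s z≤n) j<n)
        (detℕ-cong n (λ i c i<n c<n → A≡B (suc i) (punch j c) (s≤s i<n) (punch-< j c<n)))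

-- Row operations

swapRows : {R : Set} → ℕ → (ℕ → R) → ℕ → R
swapRows zero    A zero          = A 1
swapRows zero    A (suc zero)    = A 0
swapRows zero    A (suc (suc i)) = A (suc (suc i))
swapRows (suc r) A zero          = A 0
swapRows (suc r) A (suc i)       = swapRows r (A ∘ suc) i

setRow : {R : Set} → ℕ → R → (ℕ → R) → ℕ → R
setRow zero    v A zero    = v
setRow zero    v A (suc i) = A (suc i)
setRow (suc r) v A zero    = A 0
setRow (suc r) v A (suc i) = setRow r v (A ∘ suc) i

module _ {R S : Set} (f : R → S) where

  swapRows-∘ : ∀ r (A : ℕ → R) i → swapRows r (f ∘ A) i ≡ f (swapRows r A i)
  swapRows-∘ zero    A zero          = refl
  swapRows-∘ zero    A (suc zero)    = refl
  swapRows-∘ zero    A (suc (suc i)) = refl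
  swapRows-∘ (suc r) A zero          = refl
  swapRows-∘ (suc r) A (suc i)       = swapRows-∘ r (A ∘ suc) i

  setRow-∘ : ∀ r v (A : ℕ → R) i → setRow r (f v) (f ∘ A) i ≡ f (setRow r v A i)
  setRow-∘ zero    v A zero    = refl
  setRow-∘ zero    v A (suc i) = refl
  setRow-∘ (suc r) v A zero    = refl
  setRow-∘ (suc r) v A (suc i) = setRow-∘ r v (A ∘ suc) i

module _ {R : Set} where

  swapRows-fst : ∀ r (A : ℕ → R) → swapRows r A r ≡ A (suc r)
  swapRows-fst zero    A = refl
  swapRows-fst (suc r) A = swapRows-fst r (A ∘ suc)

  swapRows-other : ∀ r (A : ℕ → R) {i} → i ≢ r → i ≢ suc r → swapRows r A i ≡ A i
  swapRows-other zero    A {zero}          i≢0 _   = ⊥-elim (i≢0 refl)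
  swapRows-other zero    A {suc zero}      _   i≢1 = ⊥-elim (i≢1 refl)
  swapRows-other zero    A {suc (suc i)}   _   _   = refl
  swapRows-other (suc r) A {zero}          _   _   = refl
  swapRows-other (suc r) A {suc i} i≢r i≢r+1 =
    swapRows-other r (A ∘ suc) (i≢r ∘ cong suc) (i≢r+1 ∘ cong suc)

  setRow-same : ∀ r v (A : ℕ → R) → setRow r v A r ≡ v
  setRow-same zero    v A = refl
  setRow-same (suc r) v A = setRow-same r v (A ∘ suc)

  setRow-other : ∀ r v (A : ℕ → R) {i} → i ≢ r → setRow r v A i ≡ A i
  setRow-other zero    v A {zero}  i≢r = ⊥-elim (i≢r refl)
  setRow-other zero    v A {suc i} _   = refl
  setRow-other (suc r) v A {zero}  _   = refl
  setRow-other (suc r) v A {suc i} i≢r = setRow-other r v (A ∘ suc) (i≢r ∘ cong suc)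

  setRow-self : ∀ r (A : ℕ → R) i → setRow r (A r) A i ≡ A i
  setRow-self zero    A zero    = refl
  setRow-self zero    A (suc i) = refl
  setRow-self (suc r) A zero    = refl
  setRow-self (suc r) A (suc i) = setRow-self r (A ∘ suc) i

swapRows-≗ : ∀ r (A : Matrix) → A r ≗ A (suc r) → ∀ i → swapRows r A i ≗ A i
swapRows-≗ zero    A Ar≗Ar+1 zero          = sym ∘ Ar≗Ar+1
swapRows-≗ zero    A Ar≗Ar+1 (suc zero)    = Ar≗Ar+1
swapRows-≗ zero    A Ar≗Ar+1 (suc (suc i)) = λ _ → refl
swapRows-≗ (suc r) A Ar≗Ar+1 zero          = λ _ → refl
swapRows-≗ (suc r) A Ar≗Ar+1 (suc i)       = swapRows-≗ r (A ∘ suc) Ar≗Ar+1 i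

minor-swapRows : ∀ j r (A : Matrix) i c → minor j (swapRows (suc r) A) i c ≡ swapRows r (minor j A) i c
minor-swapRows j r A i c = sym (cong-app (swapRows-∘ (_∘ punch j) r (A ∘ suc) i) c)

minor-setRow : ∀ j r v (A : Matrix) i c → minor j (setRow (suc r) v A) i c ≡ setRow r (v ∘ punch j) (minor j A) i c
minor-setRow j r v A i c = sym (cong-app (setRow-∘ (_∘ punch j) r v (A ∘ suc) i) c)

∑ℕ-linear : ∀ n (f g : ℕ → ℤ) k → ∑ℕ n (λ j → f j + k * g j) ≡ ∑ℕ n f + k * ∑ℕ n g
∑ℕ-linear n f g k = trans (∑ℕ-distrib-+ n f (λ j → k * g j)) (cong (_+_ (∑ℕ n f)) (∑ℕ-*ˡ n k g))

detℕ-setRow-linear : ∀ {n} r (A : Matrix) (u v : ℕ → ℤ) k → r < n →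
  detℕ n (setRow r (λ j → u j + k * v j) A) ≡ detℕ n (setRow r u A) + k * detℕ n (setRow r v A)
detℕ-setRow-linear {suc n} zero A u v k _ =
  trans (∑ℕ-cong (suc n) (λ j _ → expand (sgn j) (u j) (v j) k (detℕ n (minor j A))))
        (∑ℕ-linear (suc n) (λ j → sgn j * u j * detℕ n (minor j A)) (λ j → sgn j * v j * detℕ n (minor j A)) k)
  where
  expand : ∀ s a b k d → s * (a + k * b) * d ≡ s * a * d + k * (s * b * d)
  expand = solve-∀
detℕ-setRow-linear {suc n} (suc r) A u v k (s≤s r<n) =
  trans (∑ℕ-cong (suc n) (λ j _ → trans (cong (sgn j * A 0 j *_) (minor-linear j))
                                        (expand (sgn j * A 0 j) (X j) k (Y j))))
        (∑ℕ-linear (suc n) (λ j → sgn j * A 0 j * X j) (λ j → sgn j * A 0 j * Y j) k)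
  where
  X Y : ℕ → ℤ
  X j = detℕ n (minor j (setRow (suc r) u A))
  Y j = detℕ n (minor j (setRow (suc r) v A))
  minor-linear : ∀ j → detℕ n (minor j (setRow (suc r) (λ c → u c + k * v c) A)) ≡ X j + k * Y j
  minor-linear j = begin
    detℕ n (minor j (setRow (suc r) (λ c → u c + k * v c) A))
      ≡⟨ detℕ-cong n (λ i c _ _ → minor-setRow j r _ A i c) ⟩
    detℕ n (setRow r (λ c → u (punch j c) + k * v (punch j c)) (minor j A))
      ≡⟨ detℕ-setRow-linear r (minor j A) (u ∘ punch j) (v ∘ punch j) k r<n ⟩
    detℕ n (setRow r (u ∘ punch j) (minor j A)) + k * detℕ n (setRow r (v ∘ punch j) (minor j A))
      ≡⟨ cong₂ (λ x y → x + k * y) (detℕ-cong n (λ i c _ _ → sym (minor-setRow j r u A i c)))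
                                   (detℕ-cong n (λ i c _ _ → sym (minor-setRow j r v A i c))) ⟩
    detℕ n (minor j (setRow (suc r) u A)) + k * detℕ n (minor j (setRow (suc r) v A)) ∎
    where open ≡-Reasoning
  expand : ∀ c x k y → c * (x + k * y) ≡ c * x + k * (c * y)
  expand = solve-∀

private
  sum≡0⇒≡neg : ∀ {x y : ℤ} → x + y ≡ 0ℤ → y ≡ - x
  sum≡0⇒≡neg {x} {y} x+y≡0 = trans (shuffle x y) (trans (cong (_+_ (- x)) x+y≡0) (ℤₚ.+-identityʳ (- x)))
    where
    shuffle : ∀ x y → y ≡ - x + (x + y)
    shuffle = solve-∀

  ≡neg⇒≡0 : ∀ {x : ℤ} → x ≡ - x → x ≡ 0ℤ
  ≡neg⇒≡0 {x} x≡-x = ℤₚ.*-cancelˡ-≡ (+ 2) x 0ℤ (trans (double x) (trans (cong (_+_ x) x≡-x) (ℤₚ.+-inverseʳ x)))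
    where
    double : ∀ x → + 2 * x ≡ x + x
    double = solve-∀

detℕ-swapRows-0 : ∀ m (A : Matrix) → detℕ (2 ℕ.+ m) (swapRows 0 A) ≡ - detℕ (2 ℕ.+ m) A
detℕ-swapRows-0 m A = sum≡0⇒≡neg (begin
  detℕ (2 ℕ.+ m) A + detℕ (2 ℕ.+ m) (swapRows 0 A)
    ≡⟨ cong₂ _+_ (expand A) (expand (swapRows 0 A)) ⟩
  ∑ℕ (2 ℕ.+ m) (λ j → ∑ℕ (suc m) (T A j)) + ∑ℕ (2 ℕ.+ m) (λ j → ∑ℕ (suc m) (T (swapRows 0 A) j))
    ≡⟨ ∑ℕ-distrib-+ (2 ℕ.+ m) (λ j → ∑ℕ (suc m) (T A j)) (λ j → ∑ℕ (suc m) (T (swapRows 0 A) j)) ⟨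
  ∑ℕ (2 ℕ.+ m) (λ j → ∑ℕ (suc m) (T A j) + ∑ℕ (suc m) (T (swapRows 0 A) j))
    ≡⟨ ∑ℕ-cong (2 ℕ.+ m) (λ j _ → ∑ℕ-distrib-+ (suc m) (T A j) (T (swapRows 0 A) j)) ⟨
  ∑ℕ (2 ℕ.+ m) (λ j → ∑ℕ (suc m) (λ l → T A j l + T (swapRows 0 A) j l))
    ≡⟨ ∑ℕ-pairs (suc m) (λ j l → T A j l + T (swapRows 0 A) j l) cancel ⟩
  0ℤ ∎)
  where
  open ≡-Reasoning
  D : ℕ → ℕ → ℤ
  D j l = detℕ m (minor l (minor j A))
  T : Matrix → ℕ → ℕ → ℤ
  T B j l = sgn j * B 0 j * (sgn l * B 1 (punch j l) * detℕ m (minor l (minor j B)))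
  expand : ∀ B → detℕ (2 ℕ.+ m) B ≡ ∑ℕ (2 ℕ.+ m) (λ j → ∑ℕ (suc m) (T B j))
  expand B = ∑ℕ-cong (2 ℕ.+ m) λ j _ →
    sym (∑ℕ-*ˡ (suc m) (sgn j * B 0 j) (λ l → sgn l * B 1 (punch j l) * detℕ m (minor l (minor j B))))
  cancel : ∀ j l → j ≤ l → l < suc m →
           (T A j l + T (swapRows 0 A) j l) + (T A (suc l) j + T (swapRows 0 A) (suc l) j) ≡ 0ℤ
  cancel j l j≤l _
    rewrite punch-above j≤l | punch-below (s≤s j≤l)
          | detℕ-cong m {minor j (minor (suc l) A)} (λ i c _ _ → cong (A (2 ℕ.+ i)) (sym (punch-punch c j≤l)))
    = pair (sgn j) (sgn l) (A 0 j) (A 1 j) (A 0 (suc l)) (A 1 (suc l)) (D j l)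
    where
    pair : ∀ s s′ a b a′ b′ d →
           (s * a * (s′ * b′ * d) + s * b * (s′ * a′ * d)) +
           (-1ℤ * s′ * a′ * (s * b * d) + -1ℤ * s′ * b′ * (s * a * d)) ≡ 0ℤ
    pair = solve-∀

detℕ-swapRows : ∀ {n} r (A : Matrix) → suc r < n → detℕ n (swapRows r A) ≡ - detℕ n A
detℕ-swapRows {suc (suc m)} zero A _ = detℕ-swapRows-0 m A
detℕ-swapRows {suc n} (suc r) A (s≤s r+1<n) = begin
  ∑ℕ (suc n) (λ j → sgn j * A 0 j * detℕ n (minor j (swapRows (suc r) A)))
    ≡⟨ ∑ℕ-cong (suc n) (λ j _ → cong (sgn j * A 0 j *_) (swapped-minor j)) ⟩
  ∑ℕ (suc n) (λ j → sgn j * A 0 j * - detℕ n (minor j A))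
    ≡⟨ ∑ℕ-cong (suc n) (λ j _ → pull-neg (sgn j * A 0 j) (detℕ n (minor j A))) ⟩
  ∑ℕ (suc n) (λ j → -1ℤ * (sgn j * A 0 j * detℕ n (minor j A)))
    ≡⟨ ∑ℕ-*ˡ (suc n) -1ℤ (λ j → sgn j * A 0 j * detℕ n (minor j A)) ⟩
  -1ℤ * detℕ (suc n) A
    ≡⟨ ℤₚ.-1*i≡-i (detℕ (suc n) A) ⟩
  - detℕ (suc n) A ∎
  where
  open ≡-Reasoning
  swapped-minor : ∀ j → detℕ n (minor j (swapRows (suc r) A)) ≡ - detℕ n (minor j A)
  swapped-minor j = trans (detℕ-cong n (λ i c _ _ → minor-swapRows j r A i c))
                          (detℕ-swapRows r (minor j A) r+1<n)
  pull-neg : ∀ c d → c * - d ≡ -1ℤ * (c * d)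
  pull-neg = solve-∀

detℕ-adjacentRows : ∀ {n} r (A : Matrix) → suc r < n → A r ≗ A (suc r) → detℕ n A ≡ 0ℤ
detℕ-adjacentRows {n} r A r+1<n Ar≗Ar+1 = ≡neg⇒≡0 (begin
  detℕ n A              ≡⟨ detℕ-cong n (λ i c _ _ → swapRows-≗ r A Ar≗Ar+1 i c) ⟨
  detℕ n (swapRows r A) ≡⟨ detℕ-swapRows r A r+1<n ⟩
  - detℕ n A            ∎)
  where open ≡-Reasoning

detℕ-equalRows-+ : ∀ {n} d r (A : Matrix) → d ℕ.+ suc r < n → A r ≗ A (d ℕ.+ suc r) → detℕ n A ≡ 0ℤ
detℕ-equalRows-+ zero    r A r+1<n Ar≗As = detℕ-adjacentRows r A r+1<n Ar≗As
detℕ-equalRows-+ {n} (suc d) r A s<n Ar≗As = begin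
  detℕ n A       ≡⟨ ℤₚ.neg-involutive (detℕ n A) ⟨
  - (- detℕ n A) ≡⟨ cong -_ (detℕ-swapRows q A s<n) ⟨
  - detℕ n B     ≡⟨ cong -_ (detℕ-equalRows-+ d r B (ℕₚ.<-trans (ℕₚ.n<1+n q) s<n) Br≗Bq) ⟩
  0ℤ             ∎
  where
  open ≡-Reasoning
  q = d ℕ.+ suc r
  B = swapRows q A
  r<q : r < q
  r<q = ℕₚ.m≤n+m (suc r) d
  Br≗Bq : B r ≗ B q
  Br≗Bq c = begin
    B r c       ≡⟨ cong-app (swapRows-other q A (ℕₚ.<⇒≢ r<q) (ℕₚ.<⇒≢ (ℕₚ.m<n⇒m<1+n r<q))) c ⟩
    A r c       ≡⟨ Ar≗As c ⟩
    A (suc q) c ≡⟨ cong-app (swapRows-fst q A) c ⟨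
    B q c       ∎

detℕ-equalRows-< : ∀ {n r s} (A : Matrix) → r < s → s < n → A r ≗ A s → detℕ n A ≡ 0ℤ
detℕ-equalRows-< {n} {r} {s} A r<s s<n Ar≗As =
  detℕ-equalRows-+ (s ℕ.∸ suc r) r A (subst (_< n) s≡ s<n) (λ c → trans (Ar≗As c) (cong (λ i → A i c) s≡))
  where
  s≡ : s ≡ s ℕ.∸ suc r ℕ.+ suc r
  s≡ = sym (ℕₚ.m∸n+n≡m r<s)

detℕ-equalRows : ∀ {n r s} (A : Matrix) → r < n → s < n → r ≢ s → A r ≗ A s → detℕ n A ≡ 0ℤ
detℕ-equalRows {r = r} {s} A r<n s<n r≢s Ar≗As with ℕₚ.<-cmp r s
... | tri< r<s _ _ = detℕ-equalRows-< A r<s s<n Ar≗As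
... | tri≈ _ r≡s _ = ⊥-elim (r≢s r≡s)
... | tri> _ _ s<r = detℕ-equalRows-< A s<r r<n (sym ∘ Ar≗As)

detℕ-addRow : ∀ {n r s} (A C : Matrix) k → r < n → s < n → r ≢ s →
              C r ≗ (λ j → A r j + k * A s j) → (∀ i → i ≢ r → C i ≗ A i) → detℕ n C ≡ detℕ n A
detℕ-addRow {n} {r} {s} A C k r<n s<n r≢s Cr Ci = begin
  detℕ n C
    ≡⟨ detℕ-cong n (λ i c _ _ → C≗ i c) ⟩
  detℕ n (setRow r (λ j → A r j + k * A s j) A)
    ≡⟨ detℕ-setRow-linear r A (A r) (A s) k r<n ⟩
  detℕ n (setRow r (A r) A) + k * detℕ n (setRow r (A s) A)
    ≡⟨ cong₂ (λ x y → x + k * y) (detℕ-cong n (λ i c _ _ → cong-app (setRow-self r A i) c))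
                                 (detℕ-equalRows (setRow r (A s) A) r<n s<n r≢s rows-r-s) ⟩
  detℕ n A + k * 0ℤ
    ≡⟨ cong (_+_ (detℕ n A)) (ℤₚ.*-zeroʳ k) ⟩
  detℕ n A + 0ℤ
    ≡⟨ ℤₚ.+-identityʳ (detℕ n A) ⟩
  detℕ n A ∎
  where
  open ≡-Reasoning
  C≗ : ∀ i → C i ≗ setRow r (λ j → A r j + k * A s j) A i
  C≗ i c with i ℕₚ.≟ r
  ... | yes refl = trans (Cr c) (sym (cong-app (setRow-same r _ A) c))
  ... | no i≢r   = trans (Ci i i≢r c) (sym (cong-app (setRow-other r _ A i≢r) c))
  rows-r-s : setRow r (A s) A r ≗ setRow r (A s) A s
  rows-r-s = cong-app (trans (setRow-same r (A s) A) (sym (setRow-other r (A s) A (r≢s ∘ sym))))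

-- The modifications are undone one row at a time, the last modified row first, so that
-- the row added to it is still a row of A; detℕ-addEarlierRows undoes them first row first.
detℕ-addLaterRows : ∀ {n} m (A C : Matrix) (k : ℕ → ℤ) (σ : ℕ → ℕ) →
  (∀ i → i < m → i < σ i × σ i < n) → m ≤ n →
  (∀ i → i < m → C i ≗ (λ j → A i j + k i * A (σ i) j)) → (∀ i → m ≤ i → C i ≗ A i) →
  detℕ n C ≡ detℕ n A
detℕ-addLaterRows {n} zero A C k σ _ _ _ C≗A = detℕ-cong n (λ i j _ _ → C≗A i z≤n j)
detℕ-addLaterRows {n} (suc m) A C k σ σ> m<n Ci Cj =
  trans step (detℕ-addLaterRows m A C′ k σ σ>′ (ℕₚ.<⇒≤ m<n) C′i C′j)
  where
  C′ = setRow m (A m) C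
  σ>′ : ∀ i → i < m → i < σ i × σ i < n
  σ>′ i i<m = σ> i (ℕₚ.m<n⇒m<1+n i<m)
  C′i : ∀ i → i < m → C′ i ≗ (λ j → A i j + k i * A (σ i) j)
  C′i i i<m c = trans (cong-app (setRow-other m (A m) C (ℕₚ.<⇒≢ i<m)) c) (Ci i (ℕₚ.m<n⇒m<1+n i<m) c)
  C′j : ∀ i → m ≤ i → C′ i ≗ A i
  C′j i m≤i c with i ℕₚ.≟ m
  ... | yes refl = cong-app (setRow-same m (A m) C) c
  ... | no i≢m   = trans (cong-app (setRow-other m (A m) C i≢m) c)
                         (Cj i (ℕₚ.≤∧≢⇒< m≤i (i≢m ∘ sym)) c)
  σm = σ m
  m<σm : m < σm
  m<σm = proj₁ (σ> m (ℕₚ.n<1+n m))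
  step : detℕ n C ≡ detℕ n C′
  step = detℕ-addRow C′ C (k m) m<n (proj₂ (σ> m (ℕₚ.n<1+n m))) (ℕₚ.<⇒≢ m<σm)
           (λ c → trans (Ci m (ℕₚ.n<1+n m) c)
                        (sym (cong₂ (λ x y → x + k m * y) (cong-app (setRow-same m (A m) C) c)
                                                         (C′j σm (ℕₚ.<⇒≤ m<σm) c))))
           (λ i i≢m c → sym (cong-app (setRow-other m (A m) C i≢m) c))

detℕ-addEarlierRows : ∀ {n} d m (A C : Matrix) (k : ℕ → ℤ) (σ : ℕ → ℕ) → m ℕ.+ d ≡ n →
  (∀ i → m ≤ i → σ i < i) →
  (∀ i → m ≤ i → C i ≗ (λ j → A i j + k i * A (σ i) j)) → (∀ i → i < m → C i ≗ A i) →
  detℕ n C ≡ detℕ n A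
detℕ-addEarlierRows {n} zero m A C k σ refl _ _ C≗A =
  detℕ-cong n (λ i j i<n _ → C≗A i (subst (i <_) (ℕₚ.+-identityʳ m) i<n) j)
detℕ-addEarlierRows {n} (suc d) m A C k σ refl σ< Ci Cj =
  trans step (detℕ-addEarlierRows d (suc m) A C′ k σ (sym (ℕₚ.+-suc m d)) (λ i m<i → σ< i (ℕₚ.<⇒≤ m<i)) C′i C′j)
  where
  C′ = setRow m (A m) C
  C′i : ∀ i → suc m ≤ i → C′ i ≗ (λ j → A i j + k i * A (σ i) j)
  C′i i m<i c = trans (cong-app (setRow-other m (A m) C (ℕₚ.>⇒≢ m<i)) c) (Ci i (ℕₚ.<⇒≤ m<i) c)
  C′j : ∀ i → i < suc m → C′ i ≗ A i
  C′j i i≤m c with i ℕₚ.≟ m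
  ... | yes refl = cong-app (setRow-same m (A m) C) c
  ... | no i≢m   = trans (cong-app (setRow-other m (A m) C i≢m) c)
                         (Cj i (ℕₚ.≤∧≢⇒< (ℕₚ.≤-pred i≤m) i≢m) c)
  σm<m : σ m < m
  σm<m = σ< m ℕₚ.≤-refl
  m<n : m < m ℕ.+ suc d
  m<n = ℕₚ.m<m+n m (s≤s z≤n)
  step : detℕ (m ℕ.+ suc d) C ≡ detℕ (m ℕ.+ suc d) C′
  step = detℕ-addRow C′ C (k m) m<n (ℕₚ.<-trans σm<m m<n) (ℕₚ.>⇒≢ σm<m)
           (λ c → trans (Ci m ℕₚ.≤-refl c)
                        (sym (cong₂ (λ x y → x + k m * y) (cong-app (setRow-same m (A m) C) c)
                                                         (C′j (σ m) (ℕₚ.m<n⇒m<1+n σm<m) c))))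
           (λ i i≢m c → sym (cong-app (setRow-other m (A m) C i≢m) c))

detℕ-zeroColumn : ∀ {n} c (A : Matrix) → c < n → (∀ i → A i c ≡ 0ℤ) → detℕ n A ≡ 0ℤ
detℕ-zeroColumn {suc n} c A c<n col≡0 = ∑ℕ-zero (suc n) term≡0
  where
  term≡0 : ∀ j → j < suc n → sgn j * A 0 j * detℕ n (minor j A) ≡ 0ℤ
  term≡0 j j<n with j ℕₚ.≟ c
  ... | yes refl = trans (cong (λ a → sgn j * a * detℕ n (minor j A)) (col≡0 0))
                         (cong (_* detℕ n (minor j A)) (ℤₚ.*-zeroʳ (sgn j)))
  ... | no j≢c with punch-surjective j<n c<n j≢c
  ...   | c′ , c′<n , refl = trans (cong (sgn j * A 0 j *_) (detℕ-zeroColumn c′ (minor j A) c′<n (col≡0 ∘ suc)))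
                                   (ℤₚ.*-zeroʳ (sgn j * A 0 j))

detℕ-pivot : ∀ {n} j (A : Matrix) → j < suc n → (∀ i → A (suc i) j ≡ 0ℤ) →
             detℕ (suc n) A ≡ sgn j * A 0 j * detℕ n (minor j A)
detℕ-pivot {n} j A j<n col≡0 = ∑ℕ-single (suc n) j j<n term≡0
  where
  term≡0 : ∀ i → i < suc n → i ≢ j → sgn i * A 0 i * detℕ n (minor i A) ≡ 0ℤ
  term≡0 i i<n i≢j with punch-surjective i<n j<n i≢j
  ... | c′ , c′<n , refl = trans (cong (sgn i * A 0 i *_) (detℕ-zeroColumn c′ (minor i A) c′<n col≡0))
                                 (ℤₚ.*-zeroʳ (sgn i * A 0 i))

sgn-+ : ∀ m n → sgn (m ℕ.+ n) ≡ sgn m * sgn n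
sgn-+ = ℤₚ.^-distribˡ-+-* -1ℤ

detℕ-antiBlock : ∀ r s (A : Matrix) → (∀ i j → i < r → j < s → A i j ≡ 0ℤ) →
  detℕ (r ℕ.+ s) A ≡ sgn (r ℕ.* s) * (detℕ r (λ i l → A i (s ℕ.+ l)) * detℕ s (λ i j → A (r ℕ.+ i) j))
detℕ-antiBlock zero    s A _       = sym (trans (ℤₚ.*-identityˡ _) (ℤₚ.*-identityˡ (detℕ s A)))
detℕ-antiBlock (suc r) s A block≡0 = begin
  ∑ℕ (suc (r ℕ.+ s)) term
    ≡⟨ cong (λ N → ∑ℕ N term) (ℕₚ.+-comm (suc r) s) ⟩
  ∑ℕ (s ℕ.+ suc r) term
    ≡⟨ ∑ℕ-split s (suc r) term ⟩
  ∑ℕ s term + ∑ℕ (suc r) (λ l → term (s ℕ.+ l))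
    ≡⟨ cong₂ _+_ (∑ℕ-zero s left-term≡0) (∑ℕ-cong (suc r) (λ l _ → right-term l)) ⟩
  0ℤ + ∑ℕ (suc r) (λ l → K * (sgn l * X 0 l * detℕ r (minor l X)))
    ≡⟨ ℤₚ.+-identityˡ _ ⟩
  ∑ℕ (suc r) (λ l → K * (sgn l * X 0 l * detℕ r (minor l X)))
    ≡⟨ ∑ℕ-*ˡ (suc r) K (λ l → sgn l * X 0 l * detℕ r (minor l X)) ⟩
  K * detℕ (suc r) X
    ≡⟨ regroup (sgn s) (sgn (r ℕ.* s)) (detℕ s Y) (detℕ (suc r) X) ⟩
  sgn s * sgn (r ℕ.* s) * (detℕ (suc r) X * detℕ s Y)
    ≡⟨ cong (_* (detℕ (suc r) X * detℕ s Y)) (sgn-+ s (r ℕ.* s)) ⟨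
  sgn (suc r ℕ.* s) * (detℕ (suc r) X * detℕ s Y) ∎
  where
  open ≡-Reasoning
  X Y : Matrix
  X i l = A i (s ℕ.+ l)
  Y i j = A (suc r ℕ.+ i) j
  term : ℕ → ℤ
  term j = sgn j * A 0 j * detℕ (r ℕ.+ s) (minor j A)
  K : ℤ
  K = sgn s * sgn (r ℕ.* s) * detℕ s Y
  left-term≡0 : ∀ j → j < s → term j ≡ 0ℤ
  left-term≡0 j j<s = trans (cong (λ a → sgn j * a * detℕ (r ℕ.+ s) (minor j A)) (block≡0 0 j (s≤s z≤n) j<s))
                            (cong (_* detℕ (r ℕ.+ s) (minor j A)) (ℤₚ.*-zeroʳ (sgn j)))
  minor-antiBlock : ∀ l → detℕ (r ℕ.+ s) (minor (s ℕ.+ l) A) ≡ sgn (r ℕ.* s) * (detℕ r (minor l X) * detℕ s Y)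
  minor-antiBlock l = trans
    (detℕ-antiBlock r s (minor (s ℕ.+ l) A) (λ i j i<r j<s →
      trans (cong (A (suc i)) (punch-below (ℕₚ.≤-trans j<s (ℕₚ.m≤m+n s l)))) (block≡0 (suc i) j (s≤s i<r) j<s)))
    (cong₂ (λ x y → sgn (r ℕ.* s) * (x * y))
      (detℕ-cong r (λ i c _ _ → cong (A (suc i)) (punch-+ s l c)))
      (detℕ-cong s (λ i j _ j<s → cong (A (suc r ℕ.+ i)) (punch-below (ℕₚ.≤-trans j<s (ℕₚ.m≤m+n s l))))))
  right-term : ∀ l → term (s ℕ.+ l) ≡ K * (sgn l * X 0 l * detℕ r (minor l X))
  right-term l = begin
    sgn (s ℕ.+ l) * A 0 (s ℕ.+ l) * detℕ (r ℕ.+ s) (minor (s ℕ.+ l) A)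
      ≡⟨ cong₂ (λ σ d → σ * A 0 (s ℕ.+ l) * d) (sgn-+ s l) (minor-antiBlock l) ⟩
    sgn s * sgn l * A 0 (s ℕ.+ l) * (sgn (r ℕ.* s) * (detℕ r (minor l X) * detℕ s Y))
      ≡⟨ rearrange (sgn s) (sgn l) (A 0 (s ℕ.+ l)) (sgn (r ℕ.* s)) (detℕ r (minor l X)) (detℕ s Y) ⟩
    K * (sgn l * X 0 l * detℕ r (minor l X)) ∎
    where
    rearrange : ∀ σ σ′ a τ x y → σ * σ′ * a * (τ * (x * y)) ≡ σ * τ * y * (σ′ * a * x)
    rearrange = solve-∀
  regroup : ∀ σ τ y x → σ * τ * y * x ≡ σ * τ * (x * y)
  regroup = solve-∀

detℕ-scaleRows : ∀ n (f : ℕ → ℤ) (A : Matrix) → detℕ n (λ i j → f i * A i j) ≡ ∏ℕ n f * detℕ n A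
detℕ-scaleRows zero    f A = refl
detℕ-scaleRows (suc n) f A = begin
  ∑ℕ (suc n) (λ j → sgn j * (f 0 * A 0 j) * detℕ n (λ i c → f (suc i) * A (suc i) (punch j c)))
    ≡⟨ ∑ℕ-cong (suc n) (λ j _ → cong (sgn j * (f 0 * A 0 j) *_) (detℕ-scaleRows n (f ∘ suc) (minor j A))) ⟩
  ∑ℕ (suc n) (λ j → sgn j * (f 0 * A 0 j) * (∏ℕ n (f ∘ suc) * detℕ n (minor j A)))
    ≡⟨ ∑ℕ-cong (suc n) (λ j _ → rearrange (sgn j) (f 0) (A 0 j) (∏ℕ n (f ∘ suc)) (detℕ n (minor j A))) ⟩
  ∑ℕ (suc n) (λ j → ∏ℕ (suc n) f * (sgn j * A 0 j * detℕ n (minor j A)))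
    ≡⟨ ∑ℕ-*ˡ (suc n) (∏ℕ (suc n) f) (λ j → sgn j * A 0 j * detℕ n (minor j A)) ⟩
  ∏ℕ (suc n) f * detℕ (suc n) A ∎
  where
  open ≡-Reasoning
  rearrange : ∀ σ a x P d → σ * (a * x) * (P * d) ≡ a * P * (σ * x * d)
  rearrange = solve-∀

-- Congruences

infix 4 _≈_[mod_]

-- The congruence _≡_[mod_] of Defs unfolds to a divisibility between absolute values, from
-- which unification cannot recover x and y; this record keeps them as parameters.
record _≈_[mod_] (x y : ℤ) (m : ℕ) : Set where
  constructor ≈-mod
  field
    ∣-difference : + m ∣ x - y

open _≈_[mod_]

module _ {m : ℕ} where

  ≈⇒≡-mod : ∀ {x y} → x ≈ y [mod m ] → x ≡ y [mod m ]
  ≈⇒≡-mod = ℤ∣.∣⇒∣ᵤ ∘ ∣-difference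

  ≡-mod⇒≈ : ∀ x y → x ≡ y [mod m ] → x ≈ y [mod m ]
  ≡-mod⇒≈ x y = ≈-mod ∘ ℤ∣.∣ᵤ⇒∣

  ≈-reflexive : ∀ {x y} → x ≡ y → x ≈ y [mod m ]
  ≈-reflexive {x} refl = ≈-mod (divides 0ℤ (ℤₚ.+-inverseʳ x))

  ≈-refl : ∀ {x} → x ≈ x [mod m ]
  ≈-refl = ≈-reflexive refl

  ≈-sym : ∀ {x y} → x ≈ y [mod m ] → y ≈ x [mod m ]
  ≈-sym {x} {y} (≈-mod m∣x-y) = ≈-mod (subst (+ m ∣_) (flip x y) (ℤ∣.∣m⇒∣-m m∣x-y))
    where
    flip : ∀ x y → - (x - y) ≡ y - x
    flip = solve-∀

  ≈-trans : ∀ {x y z} → x ≈ y [mod m ] → y ≈ z [mod m ] → x ≈ z [mod m ]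
  ≈-trans {x} {y} {z} (≈-mod m∣x-y) (≈-mod m∣y-z) =
    ≈-mod (subst (+ m ∣_) (telescope x y z) (ℤ∣.∣m∣n⇒∣m+n m∣x-y m∣y-z))
    where
    telescope : ∀ x y z → (x - y) + (y - z) ≡ x - z
    telescope = solve-∀

  +-cong-mod : ∀ {x x′ y y′} → x ≈ x′ [mod m ] → y ≈ y′ [mod m ] → x + y ≈ x′ + y′ [mod m ]
  +-cong-mod {x} {x′} {y} {y′} (≈-mod m∣x-x′) (≈-mod m∣y-y′) =
    ≈-mod (subst (+ m ∣_) (regroup x x′ y y′) (ℤ∣.∣m∣n⇒∣m+n m∣x-x′ m∣y-y′))
    where
    regroup : ∀ x x′ y y′ → (x - x′) + (y - y′) ≡ (x + y) - (x′ + y′)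
    regroup = solve-∀

  *-cong-mod : ∀ {x x′ y y′} → x ≈ x′ [mod m ] → y ≈ y′ [mod m ] → x * y ≈ x′ * y′ [mod m ]
  *-cong-mod {x} {x′} {y} {y′} (≈-mod m∣x-x′) (≈-mod m∣y-y′) =
    ≈-mod (subst (+ m ∣_) (regroup x x′ y y′)
                 (ℤ∣.∣m∣n⇒∣m+n (ℤ∣.∣n⇒∣m*n x m∣y-y′) (ℤ∣.∣n⇒∣m*n y′ m∣x-x′)))
    where
    regroup : ∀ x x′ y y′ → x * (y - y′) + y′ * (x - x′) ≡ x * y - x′ * y′
    regroup = solve-∀

  -‿cong-mod : ∀ {x x′ y y′} → x ≈ x′ [mod m ] → y ≈ y′ [mod m ] → x - y ≈ x′ - y′ [mod m ]
  -‿cong-mod {x} {x′} {y} {y′} (≈-mod m∣x-x′) (≈-mod m∣y-y′) =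
    ≈-mod (subst (+ m ∣_) (regroup x x′ y y′) (ℤ∣.∣m∣n⇒∣m-n m∣x-x′ m∣y-y′))
    where
    regroup : ∀ x x′ y y′ → (x - x′) - (y - y′) ≡ (x - y) - (x′ - y′)
    regroup = solve-∀

  ^-cong-mod : ∀ {x x′} n → x ≈ x′ [mod m ] → x ^ n ≈ x′ ^ n [mod m ]
  ^-cong-mod zero    _     = ≈-refl
  ^-cong-mod (suc n) x≈x′ = *-cong-mod x≈x′ (^-cong-mod n x≈x′)

  ∣⇒≈0 : ∀ {x} → + m ∣ x → x ≈ 0ℤ [mod m ]
  ∣⇒≈0 {x} m∣x = ≈-mod (subst (+ m ∣_) (sym (ℤₚ.+-identityʳ x)) m∣x)

  ≈0⇒∣ : ∀ {x} → x ≈ 0ℤ [mod m ] → + m ∣ x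
  ≈0⇒∣ {x} = subst (+ m ∣_) (ℤₚ.+-identityʳ x) ∘ ∣-difference

  ∣-resp-≈ : ∀ {x y} → x ≈ y [mod m ] → + m ∣ x → + m ∣ y
  ∣-resp-≈ {x} {y} (≈-mod m∣x-y) m∣x = subst (+ m ∣_) (cancel x y) (ℤ∣.∣m∣n⇒∣m-n m∣x m∣x-y)
    where
    cancel : ∀ x y → x - (x - y) ≡ y
    cancel = solve-∀

≈-mod-∣ : ∀ {m n x y} → m ℕ∣.∣ n → x ≈ y [mod n ] → x ≈ y [mod m ]
≈-mod-∣ m∣n (≈-mod n∣x-y) = ≈-mod (ℤ∣.∣-trans (ℤ∣.∣ᵤ⇒∣ m∣n) n∣x-y)

infix 4 _∤_

_∤_ : ℤ → ℤ → Set
k ∤ x = ¬ (k ∣ x)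

∤-flip : ∀ {k x y} → k ∤ x - y → k ∤ y - x
∤-flip {k} {x} {y} k∤x-y k∣y-x = k∤x-y (subst (k ∣_) (flip y x) (ℤ∣.∣m⇒∣-m k∣y-x))
  where
  flip : ∀ y x → - (y - x) ≡ x - y
  flip = solve-∀

≈-multiple : ∀ {m x y} q → x ≡ y + q * + m → x ≈ y [mod m ]
≈-multiple {m} {x} {y} q x≡y+qm = ≈-mod (divides q (trans (cong (_- y) x≡y+qm) (cancel y (q * + m))))
  where
  cancel : ∀ y z → y + z - y ≡ z
  cancel = solve-∀

≈-multiple² : ∀ {m x y} q → x ≡ y + q * (+ m * + m) → x ≈ y [mod m ℕ.* m ]
≈-multiple² {m} {y = y} q x≡y+qmm = ≈-multiple q (trans x≡y+qmm (cong (λ M → y + q * M) (sym (ℤₚ.pos-* m m))))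

≈-setoid : ℕ → Setoid _ _
≈-setoid m = record
  { Carrier       = ℤ
  ; _≈_           = _≈_[mod m ]
  ; isEquivalence = record { refl = ≈-refl ; sym = ≈-sym ; trans = ≈-trans }
  }

module ≈-Reasoning (m : ℕ) = Relation.Binary.Reasoning.Setoid (≈-setoid m)

*-cancelˡ-≈ : ∀ m .{{_ : NonZero m}} {a b} → + m * a ≈ + m * b [mod m ℕ.* m ] → a ≈ b [mod m ]
*-cancelˡ-≈ m {a} {b} (≈-mod (divides q eq)) =
  ≈-mod (divides q (ℤₚ.*-cancelˡ-≡ (+ m) (a - b) (q * + m) (trans (expand (+ m) a b) (trans eq (regroup q)))))
  where
  expand : ∀ m a b → m * (a - b) ≡ m * a - m * b
  expand = solve-∀
  regroup : ∀ q → q * + (m ℕ.* m) ≡ + m * (q * + m)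
  regroup q = trans (cong (q *_) (ℤₚ.pos-* m m)) (swap q (+ m))
    where
    swap : ∀ q m → q * (m * m) ≡ m * (q * m)
    swap = solve-∀

binomial-mod² : ∀ m k x u → (x + + m * u) ^ suc k ≈ x ^ suc k + + suc k * x ^ k * (+ m * u) [mod m ℕ.* m ]
binomial-mod² m zero    x u = ≈-reflexive (linear x (+ m * u))
  where
  linear : ∀ x y → (x + y) * 1ℤ ≡ x * 1ℤ + + 1 * 1ℤ * y
  linear = solve-∀
binomial-mod² m (suc k) x u = begin
  (x + + m * u) * (x + + m * u) ^ suc k
    ≈⟨ *-cong-mod (≈-refl {x = x + + m * u}) (binomial-mod² m k x u) ⟩
  (x + + m * u) * (x ^ suc k + + suc k * x ^ k * (+ m * u))
    ≈⟨ ≈-multiple² {m} (+ suc k * x ^ k * u * u) (expand x (+ m) u (x ^ k) (+ suc k)) ⟩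
  x ^ suc (suc k) + + suc (suc k) * x ^ suc k * (+ m * u) ∎
  where
  open ≈-Reasoning (m ℕ.* m)
  expand : ∀ x m u X K → (x + m * u) * (x * X + K * X * (m * u)) ≡
                         x * (x * X) + (1ℤ + K) * (x * X) * (m * u) + K * X * u * u * (m * m)
  expand = solve-∀

∑≡∑ℕ : ∀ n (f : ℕ → ℤ) → ∑ n (f ∘ toℕ) ≡ ∑ℕ n f
∑≡∑ℕ zero    f = refl
∑≡∑ℕ (suc n) f = cong (_+_ (f 0)) (∑≡∑ℕ n (f ∘ suc))

toℕ-punchIn : ∀ {n} (j : Fin (suc n)) (c : Fin n) → toℕ (punchIn j c) ≡ punch (toℕ j) (toℕ c)
toℕ-punchIn zero    c       = refl
toℕ-punchIn (suc j) zero    = refl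
toℕ-punchIn (suc j) (suc c) = cong suc (toℕ-punchIn j c)

det≈detℕ : ∀ {m} n (M : Fin n → Fin n → ℤ) (A : Matrix) →
           (∀ i j → M i j ≈ A (toℕ i) (toℕ j) [mod m ]) → det n M ≈ detℕ n A [mod m ]
det≈detℕ {m} zero    M A M≈A = ≈-refl
det≈detℕ {m} (suc n) M A M≈A = begin
  ∑ (suc n) (λ j → sgn (toℕ j) * M zero j * det n (λ r c → M (suc r) (punchIn j c)))
    ≈⟨ ∑-cong-mod (λ j → *-cong-mod (*-cong-mod (≈-refl {x = sgn (toℕ j)}) (M≈A zero j))
                                     (det≈detℕ n _ (minor (toℕ j) A) (minor-≈ j))) ⟩
  ∑ (suc n) (λ j → sgn (toℕ j) * A 0 (toℕ j) * detℕ n (minor (toℕ j) A))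
    ≡⟨ ∑≡∑ℕ (suc n) (λ j → sgn j * A 0 j * detℕ n (minor j A)) ⟩
  detℕ (suc n) A ∎
  where
  open ≈-Reasoning m
  minor-≈ : ∀ j r c → M (suc r) (punchIn j c) ≈ minor (toℕ j) A (toℕ r) (toℕ c) [mod m ]
  minor-≈ j r c = subst (λ k → M (suc r) (punchIn j c) ≈ A (suc (toℕ r)) k [mod m ]) (toℕ-punchIn j c)
                        (M≈A (suc r) (punchIn j c))
  ∑-cong-mod : ∀ {k} {f g : Fin k → ℤ} → (∀ i → f i ≈ g i [mod m ]) → ∑ k f ≈ ∑ k g [mod m ]
  ∑-cong-mod {zero}  f≈g = ≈-refl
  ∑-cong-mod {suc k} f≈g = +-cong-mod (f≈g zero) (∑-cong-mod (f≈g ∘ suc))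

extend : ∀ {n} {A : Set} → A → (Fin n → A) → ℕ → A
extend {zero}  a f _       = a
extend {suc n} a f zero    = f zero
extend {suc n} a f (suc i) = extend a (f ∘ suc) i

extend-toℕ : ∀ {n} {A : Set} (a : A) (f : Fin n → A) k → extend a f (toℕ k) ≡ f k
extend-toℕ a f zero    = refl
extend-toℕ a f (suc k) = extend-toℕ a (f ∘ suc) k

extend-fromℕ< : ∀ {n} {A : Set} (a : A) (f : Fin n → A) {k} (k<n : k < n) → extend a f k ≡ f (fromℕ< k<n)
extend-fromℕ< a f {k} k<n = trans (cong (extend a f) (sym (Finₚ.toℕ-fromℕ< k<n))) (extend-toℕ a f (fromℕ< k<n))

extend-injective : ∀ {n} {A : Set} (a : A) {f : Fin n → A} → (∀ {k l} → f k ≡ f l → k ≡ l) →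
                   ∀ {k l} → k < n → l < n → extend a f k ≡ extend a f l → k ≡ l
extend-injective a {f} f-injective {k} {l} k<n l<n fk≡fl = begin
  k                   ≡⟨ Finₚ.toℕ-fromℕ< k<n ⟨
  toℕ (fromℕ< k<n)    ≡⟨ cong toℕ (f-injective (trans (sym (extend-fromℕ< a f k<n))
                                                     (trans fk≡fl (extend-fromℕ< a f l<n)))) ⟩
  toℕ (fromℕ< l<n)    ≡⟨ Finₚ.toℕ-fromℕ< l<n ⟩
  l                   ∎
  where open ≡-Reasoning

-- The ℕ-indexed counterpart of [ f , g ]′ ∘ splitAt t.
splitℕ : {A : Set} → ℕ → (ℕ → A) → (ℕ → A) → ℕ → A
splitℕ zero    f g j       = g j
splitℕ (suc t) f g zero    = f zero
splitℕ (suc t) f g (suc j) = splitℕ t (f ∘ suc) g j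

splitℕ-< : ∀ {A : Set} t (f g : ℕ → A) {j} → j < t → splitℕ t f g j ≡ f j
splitℕ-< (suc t) f g {zero}  _         = refl
splitℕ-< (suc t) f g {suc j} (s≤s j<t) = splitℕ-< t (f ∘ suc) g j<t

splitℕ-+ : ∀ {A : Set} t (f g : ℕ → A) j → splitℕ t f g (t ℕ.+ j) ≡ g j
splitℕ-+ zero    f g j = refl
splitℕ-+ (suc t) f g j = splitℕ-+ t (f ∘ suc) g j

splitℕ-cong : ∀ {A : Set} t {f f′ g g′ : ℕ → A} → f ≗ f′ → g ≗ g′ →
              ∀ j → splitℕ t f g j ≡ splitℕ t f′ g′ j
splitℕ-cong zero    f≗f′ g≗g′ j       = g≗g′ j
splitℕ-cong (suc t) f≗f′ g≗g′ zero    = f≗f′ 0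
splitℕ-cong (suc t) f≗f′ g≗g′ (suc j) = splitℕ-cong t (f≗f′ ∘ suc) g≗g′ j

splitℕ-≥ : ∀ {A : Set} t (f f′ g : ℕ → A) {j} → t ≤ j → splitℕ t f g j ≡ splitℕ t f′ g j
splitℕ-≥ zero    f f′ g         _         = refl
splitℕ-≥ (suc t) f f′ g {suc j} (s≤s t≤j) = splitℕ-≥ t (f ∘ suc) (f′ ∘ suc) g t≤j

splitℕ-zipWith : ∀ {A B D : Set} (_∙_ : A → B → D) t f g f′ g′ j →
                 splitℕ t f g j ∙ splitℕ t f′ g′ j ≡ splitℕ t (λ k → f k ∙ f′ k) (λ k → g k ∙ g′ k) j
splitℕ-zipWith _∙_ zero    f g f′ g′ j       = refl
splitℕ-zipWith _∙_ (suc t) f g f′ g′ zero    = refl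
splitℕ-zipWith _∙_ (suc t) f g f′ g′ (suc j) = splitℕ-zipWith _∙_ t (f ∘ suc) g (f′ ∘ suc) g′ j

[,]-splitAt≈splitℕ : ∀ {m} t {n} (f : Fin t → ℤ) (g : Fin n → ℤ) (F G : ℕ → ℤ) →
  (∀ k → f k ≈ F (toℕ k) [mod m ]) → (∀ k → g k ≈ G (toℕ k) [mod m ]) →
  ∀ j → [ f , g ]′ (splitAt t j) ≈ splitℕ t F G (toℕ j) [mod m ]
[,]-splitAt≈splitℕ zero    f g F G f≈F g≈G j       = g≈G j
[,]-splitAt≈splitℕ (suc t) f g F G f≈F g≈G zero    = f≈F zero
[,]-splitAt≈splitℕ (suc t) f g F G f≈F g≈G (suc j) =
  subst (_≈ splitℕ t (F ∘ suc) G (toℕ j) [mod _ ]) (sym ([,]-map (splitAt t j)))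
        ([,]-splitAt≈splitℕ t (f ∘ suc) g (F ∘ suc) G (f≈F ∘ suc) g≈G j)

data SplitView (m n : ℕ) : Fin (m ℕ.+ n) → Set where
  left  : ∀ k → SplitView m n (k ↑ˡ n)
  right : ∀ k → SplitView m n (m ↑ʳ k)

splitView : ∀ m {n} (i : Fin (m ℕ.+ n)) → SplitView m n i
splitView zero    i       = right i
splitView (suc m) zero    = left zero
splitView (suc m) (suc i) with splitView m i
... | left k  = left (suc k)
... | right k = right k

-- Fermat's little theorem and the Fermat quotient

^ᴿ≡^ : ∀ x n → x ^ᴿ n ≡ x ^ n
^ᴿ≡^ x zero    = refl
^ᴿ≡^ x (suc n) = cong (x *_) (^ᴿ≡^ x n)

^-distrib-* : ∀ x y n → (x * y) ^ n ≡ x ^ n * y ^ n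
^-distrib-* x y n = trans (sym (^ᴿ≡^ (x * y) n))
                          (trans (ExpProperties.^-distrib-* x y n) (cong₂ _*_ (^ᴿ≡^ x n) (^ᴿ≡^ y n)))

^-^-comm : ∀ x m n → (x ^ m) ^ n ≡ (x ^ n) ^ m
^-^-comm x m n = trans (ℤₚ.^-*-assoc x m n) (trans (cong (x ^_) (ℕₚ.*-comm m n)) (sym (ℤₚ.^-*-assoc x n m)))

×ᴿ≡* : ∀ n x → n ×ᴿ x ≡ + n * x
×ᴿ≡* zero    x = refl
×ᴿ≡* (suc n) x = trans (cong (_+_ x) (×ᴿ≡* n x)) (sym (ℤₚ.suc-* (+ n) x))

∣-sum : ∀ {d n} (f : Fin n → ℤ) → (∀ k → d ∣ f k) → d ∣ sum f
∣-sum {n = zero}  f d∣f = divides 0ℤ refl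
∣-sum {n = suc n} f d∣f = ℤ∣.∣m∣n⇒∣m+n (d∣f zero) (∣-sum (f ∘ suc) (d∣f ∘ suc))

freshmansDream : ∀ {d} n → (∀ k → 0 < k → k < suc n → d ℕ∣.∣ suc n choose k) →
               ∀ y → (1ℤ + y) ^ suc n ≈ y ^ suc n + 1ℤ [mod d ]
freshmansDream {d} n d∣C y = begin
  (1ℤ + y) ^ suc n                          ≡⟨ ^ᴿ≡^ (1ℤ + y) (suc n) ⟨
  (1ℤ + y) ^ᴿ suc n                         ≡⟨ Binomial.theorem (suc n) 1ℤ y ⟩
  term zero + sum (term ∘ suc)              ≡⟨ cong (_+_ (term zero)) (sum-init-last (term ∘ suc)) ⟩
  term zero + (sum inner + term (fromℕ (suc n)))
    ≈⟨ +-cong-mod (≈-refl {x = term zero})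
                  (+-cong-mod (∣⇒≈0 (∣-sum inner d∣inner)) (≈-refl {x = term (fromℕ (suc n))})) ⟩
  term zero + (0ℤ + term (fromℕ (suc n)))   ≡⟨ cong₂ (λ a b → a + (0ℤ + b)) first-term last-term ⟩
  y ^ suc n + (0ℤ + 1ℤ)                     ≡⟨⟩
  y ^ suc n + 1ℤ                            ∎
  where
  open ≈-Reasoning d
  term : Fin (2 ℕ.+ n) → ℤ
  term = Binomial.binomialTerm 1ℤ y (suc n)
  inner : Fin n → ℤ
  inner = init (term ∘ suc)
  d∣inner : ∀ k → + d ∣ inner k
  d∣inner k = subst (+ d ∣_) (sym (×ᴿ≡* (suc n choose toℕ i) (Binomial.binomial 1ℤ y (suc n) i)))
    (ℤ∣.∣m⇒∣m*n {m = + (suc n choose toℕ i)} (Binomial.binomial 1ℤ y (suc n) i)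
      (ℤ∣.∣ᵤ⇒∣ (d∣C (toℕ i) (s≤s z≤n) (s≤s (subst (_< n) (sym (Finₚ.toℕ-inject₁ k)) (Finₚ.toℕ<n k))))))
    where
    i = suc (inject₁ k)
  first-term : term zero ≡ y ^ suc n
  first-term = trans (×ᴿ≡* 1 (1ℤ * y ^ᴿ suc n))
                     (trans (ℤₚ.*-identityˡ _) (trans (ℤₚ.*-identityˡ _) (^ᴿ≡^ y (suc n))))
  last-term : term (fromℕ (suc n)) ≡ 1ℤ
  last-term = trans (cong (λ t → (suc n choose t) ×ᴿ (1ℤ ^ᴿ t * y ^ᴿ (suc n ℕ.∸ t))) (Finₚ.toℕ-fromℕ (suc n)))
                    (trans (cong₂ (λ c e → c ×ᴿ (1ℤ ^ᴿ suc n * y ^ᴿ e)) (nCn≡1 (suc n)) (ℕₚ.n∸n≡0 n))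
                           (trans (×ᴿ≡* 1 (1ℤ ^ᴿ suc n * 1ℤ))
                                  (trans (ℤₚ.*-identityˡ _) (trans (ℤₚ.*-identityʳ _)
                                         (trans (^ᴿ≡^ 1ℤ (suc n)) (ℤₚ.^-zeroˡ (suc n)))))))

≈-%ℕ : ∀ x m .{{_ : NonZero m}} → x ≈ + (x %ℕ m) [mod m ]
≈-%ℕ x m = ≈-multiple (x /ℕ m) (a≡a%ℕn+[a/ℕn]*n x m)

[n/ℕd]*d≡n : ∀ n d .{{_ : NonZero d}} → + d ∣ n → (n /ℕ d) * + d ≡ n
[n/ℕd]*d≡n n d d∣n =
  sym (trans (a≡a%ℕn+[a/ℕn]*n n d) (trans (cong (λ r → + r + (n /ℕ d) * + d) remainder≡0) (ℤₚ.+-identityˡ _)))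
  where
  remainder≡0 : n %ℕ d ≡ 0
  remainder≡0 with n %ℕ d in eq
  ... | zero  = refl
  ... | suc r = ⊥-elim (ℕₚ.<⇒≱ (subst (ℕ._< d) eq (n%ℕd<d n d))
                               (ℕ∣.∣⇒≤ (ℤ∣.∣⇒∣ᵤ (∣-resp-≈ (subst (λ s → n ≈ + s [mod d ]) eq (≈-%ℕ n d)) d∣n))))

n∣n! : ∀ {n} → 1 ≤ n → n ℕ∣.∣ n !
n∣n! {suc n} _ = ℕ∣.m∣m*n (n !)

nCk*k![n-k]!≡n! : ∀ {n k} → k ≤ n → (n choose k) ℕ.* (k ! ℕ.* (n ℕ.∸ k) !) ≡ n !
nCk*k![n-k]!≡n! {n} {k} k≤n = trans (cong (ℕ._* (k ! ℕ.* (n ℕ.∸ k) !)) (nCk≡n!/k![n-k]! k≤n))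
                                    (m/n*n≡m {{k ℕₚ.!* (n ℕ.∸ k) !≢0}} (k![n∸k]!∣n! k≤n))

module FermatQuotient {p : ℕ} (pp : Prime p) where

  1<p : 1 < p
  1<p = ℕ.nonTrivial⇒n>1 p {{prime⇒nonTrivial pp}}

  instance
    p≢0 : NonZero p
    p≢0 = prime⇒nonZero pp

  p≡1+[p-1] : p ≡ suc (p ℕ.∸ 1)
  p≡1+[p-1] = sym (ℕₚ.m+[n∸m]≡n (ℕₚ.<⇒≤ 1<p))

  p-1≡1+[p-2] : p ℕ.∸ 1 ≡ suc (p ℕ.∸ 2)
  p-1≡1+[p-2] = ℕₚ.+-∸-assoc 1 {p} {2} 1<p

  p∤m! : ∀ {m} → m < p → ¬ (p ℕ∣.∣ m !)
  p∤m! {zero}  _   p∣1 = ℕₚ.<⇒≢ 1<p (sym (ℕ∣.∣1⇒≡1 p∣1))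
  p∤m! {suc m} m<p p∣m! with euclidsLemma (suc m) (m !) pp p∣m!
  ... | inj₁ p∣m+1 = ℕₚ.<⇒≱ m<p (ℕ∣.∣⇒≤ p∣m+1)
  ... | inj₂ p∣m!  = p∤m! (ℕₚ.<-trans (ℕₚ.n<1+n m) m<p) p∣m!

  p∣pCk : ∀ {k} → 0 < k → k < p → p ℕ∣.∣ p choose k
  p∣pCk {k} 0<k k<p with euclidsLemma (p choose k) (k ! ℕ.* (p ℕ.∸ k) !) pp p∣pCk*k![p-k]!
    where
    p∣pCk*k![p-k]! : p ℕ∣.∣ (p choose k) ℕ.* (k ! ℕ.* (p ℕ.∸ k) !)
    p∣pCk*k![p-k]! = subst (p ℕ∣.∣_) (sym (nCk*k![n-k]!≡n! (ℕₚ.<⇒≤ k<p))) (n∣n! (ℕₚ.<⇒≤ 1<p))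
  ... | inj₁ p∣pCk = p∣pCk
  ... | inj₂ p∣k![p-k]! with euclidsLemma (k !) ((p ℕ.∸ k) !) pp p∣k![p-k]!
  ...   | inj₁ p∣k!     = ⊥-elim (p∤m! k<p p∣k!)
  ...   | inj₂ p∣[p-k]! = ⊥-elim (p∤m! (ℕₚ.∸-monoʳ-< 0<k (ℕₚ.<⇒≤ k<p)) p∣[p-k]!)

  frobenius : ∀ y → (1ℤ + y) ^ p ≈ y ^ p + 1ℤ [mod p ]
  frobenius y = subst (λ q → (1ℤ + y) ^ q ≈ y ^ q + 1ℤ [mod p ]) (sym p≡1+[p-1])
    (freshmansDream (p ℕ.∸ 1) (λ k 0<k k<p → subst (λ q → p ℕ∣.∣ q choose k) p≡1+[p-1]
                                             (p∣pCk 0<k (subst (k <_) (sym p≡1+[p-1]) k<p))) y)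

  fermat : ∀ x → x ^ p ≈ x [mod p ]
  fermat x = begin
    x ^ p         ≈⟨ ^-cong-mod p (≈-%ℕ x p) ⟩
    (+ r) ^ p     ≈⟨ fermat-ℕ r ⟩
    + r           ≈⟨ ≈-sym (≈-%ℕ x p) ⟩
    x             ∎
    where
    open ≈-Reasoning p
    r = x %ℕ p
    fermat-ℕ : ∀ n → (+ n) ^ p ≈ + n [mod p ]
    fermat-ℕ zero    = ≈-reflexive (subst (λ q → 0ℤ ^ q ≡ 0ℤ) (sym p≡1+[p-1]) refl)
    fermat-ℕ (suc n) = begin
      (1ℤ + + n) ^ p ≈⟨ frobenius (+ n) ⟩
      (+ n) ^ p + 1ℤ ≈⟨ +-cong-mod (fermat-ℕ n) (≈-refl {x = 1ℤ}) ⟩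
      + n + 1ℤ       ≡⟨ ℤₚ.+-comm (+ n) 1ℤ ⟩
      + suc n        ∎

  euclidsLemmaℤ : ∀ {x y} → + p ∣ x * y → + p ∣ x ⊎ + p ∣ y
  euclidsLemmaℤ {x} {y} p∣xy
    with euclidsLemma ℤ.∣ x ∣ ℤ.∣ y ∣ pp (subst (p ℕ∣.∣_) (ℤₚ.abs-* x y) (ℤ∣.∣⇒∣ᵤ p∣xy))
  ... | inj₁ p∣x = inj₁ (ℤ∣.∣ᵤ⇒∣ p∣x)
  ... | inj₂ p∣y = inj₂ (ℤ∣.∣ᵤ⇒∣ p∣y)

  ∤-* : ∀ {x y} → + p ∤ x → + p ∤ y → + p ∤ x * y
  ∤-* p∤x p∤y p∣xy with euclidsLemmaℤ p∣xy
  ... | inj₁ p∣x = p∤x p∣x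
  ... | inj₂ p∣y = p∤y p∣y

  ∤-abs1 : ∀ {x} → ℤ.∣ x ∣ ≡ 1 → + p ∤ x
  ∤-abs1 ∣x∣≡1 p∣x = ℕₚ.<⇒≢ 1<p (sym (ℕ∣.∣1⇒≡1 (subst (p ℕ∣.∣_) ∣x∣≡1 (ℤ∣.∣⇒∣ᵤ p∣x))))

  ∤-^ : ∀ {x} n → + p ∤ x → + p ∤ x ^ n
  ∤-^ zero    _   = ∤-abs1 refl
  ∤-^ (suc n) p∤x = ∤-* p∤x (∤-^ n p∤x)

  ∤-sgn : ∀ n → + p ∤ sgn n
  ∤-sgn n = ∤-^ n (∤-abs1 refl)

  ∤-∏ℕ : ∀ n {f : ℕ → ℤ} → (∀ i → i < n → + p ∤ f i) → + p ∤ ∏ℕ n f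
  ∤-∏ℕ zero    _   = ∤-abs1 refl
  ∤-∏ℕ (suc n) p∤f = ∤-* (p∤f 0 (s≤s z≤n)) (∤-∏ℕ n (λ i i<n → p∤f (suc i) (s≤s i<n)))

  ∤-resp-≈ : ∀ {x y} → x ≈ y [mod p ] → + p ∤ x → + p ∤ y
  ∤-resp-≈ x≈y p∤x p∣y = p∤x (∣-resp-≈ (≈-sym x≈y) p∣y)

  fermat-unit : ∀ {x} → + p ∤ x → x ^ (p ℕ.∸ 1) ≈ 1ℤ [mod p ]
  fermat-unit {x} p∤x with euclidsLemmaℤ (subst (+ p ∣_) factor (∣-difference (fermat x)))
    where
    factor : x ^ p - x ≡ x * (x ^ (p ℕ.∸ 1) - 1ℤ)
    factor = trans (cong (λ q → x ^ q - x) p≡1+[p-1]) (expand x (x ^ (p ℕ.∸ 1)))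
      where
      expand : ∀ x y → x * y - x ≡ x * (y - 1ℤ)
      expand = solve-∀
  ... | inj₁ p∣x        = ⊥-elim (p∤x p∣x)
  ... | inj₂ p∣x^[p-1]-1 = ≈-mod p∣x^[p-1]-1

  e : ℤ → ℤ
  e = e₂ p pp

  -- e₂ divides with rounding down; Fermat's little theorem makes the division exact.
  p*e₂ : ∀ {x} → + p ∤ x → + p * e x ≡ x ^ (p ℕ.∸ 1) - 1ℤ
  p*e₂ {x} p∤x with p ℕ∣.∣? ℤ.∣ x ∣
  ... | yes p∣x = ⊥-elim (p∤x (ℤ∣.∣ᵤ⇒∣ p∣x))
  ... | no  _   = trans (ℤₚ.*-comm (+ p) _) ([n/ℕd]*d≡n _ p (∣-difference (fermat-unit p∤x)))

  e₂[1]≡0 : e 1ℤ ≡ 0ℤ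
  e₂[1]≡0 = ℤₚ.*-cancelˡ-≡ (+ p) (e 1ℤ) 0ℤ
             (trans (p*e₂ (∤-abs1 refl)) (trans (cong (_- 1ℤ) (ℤₚ.^-zeroˡ (p ℕ.∸ 1))) (sym (ℤₚ.*-zeroʳ (+ p)))))

  x^[p-1]≡1+p*e₂ : ∀ {x} → + p ∤ x → x ^ (p ℕ.∸ 1) ≡ 1ℤ + + p * e x
  x^[p-1]≡1+p*e₂ {x} p∤x = trans (shift (x ^ (p ℕ.∸ 1))) (cong (_+_ 1ℤ) (sym (p*e₂ p∤x)))
    where
    shift : ∀ z → z ≡ 1ℤ + (z - 1ℤ)
    shift = solve-∀

  e₂-* : ∀ {x y} → + p ∤ x → + p ∤ y → e (x * y) ≈ e x + e y [mod p ]
  e₂-* {x} {y} p∤x p∤y = *-cancelˡ-≈ p (≈-multiple² {p} (e x * e y) (begin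
    + p * e (x * y)
      ≡⟨ p*e₂ (∤-* p∤x p∤y) ⟩
    (x * y) ^ (p ℕ.∸ 1) - 1ℤ
      ≡⟨ cong (_- 1ℤ) (^-distrib-* x y (p ℕ.∸ 1)) ⟩
    x ^ (p ℕ.∸ 1) * y ^ (p ℕ.∸ 1) - 1ℤ
      ≡⟨ cong₂ (λ X Y → X * Y - 1ℤ) (x^[p-1]≡1+p*e₂ p∤x) (x^[p-1]≡1+p*e₂ p∤y) ⟩
    (1ℤ + + p * e x) * (1ℤ + + p * e y) - 1ℤ
      ≡⟨ expand (+ p) (e x) (e y) ⟩
    + p * (e x + e y) + e x * e y * (+ p * + p) ∎))
    where
    open ≡-Reasoning
    expand : ∀ P a b → (1ℤ + P * a) * (1ℤ + P * b) - 1ℤ ≡ P * (a + b) + a * b * (P * P)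
    expand = solve-∀

  e₂-^ : ∀ {x} → + p ∤ x → ∀ n → e (x ^ n) ≈ + n * e x [mod p ]
  e₂-^ p∤x zero    = ≈-reflexive e₂[1]≡0
  e₂-^ {x} p∤x (suc n) = begin
    e (x * x ^ n)       ≈⟨ e₂-* p∤x (∤-^ n p∤x) ⟩
    e x + e (x ^ n)     ≈⟨ +-cong-mod (≈-refl {x = e x}) (e₂-^ p∤x n) ⟩
    e x + + n * e x     ≡⟨ ℤₚ.suc-* (+ n) (e x) ⟨
    + suc n * e x       ∎
    where open ≈-Reasoning p

  e₂-cong : ∀ {x y} → x ≈ y [mod p ℕ.* p ] → + p ∤ x → e x ≈ e y [mod p ]
  e₂-cong {x} {y} x≈y p∤x = *-cancelˡ-≈ p (≈-mod (subst (+ (p ℕ.* p) ∣_) (sym difference)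
                                                         (∣-difference (^-cong-mod (p ℕ.∸ 1) x≈y))))
    where
    p∤y = ∤-resp-≈ (≈-mod-∣ (ℕ∣.m∣m*n p) x≈y) p∤x
    difference : + p * e x - + p * e y ≡ x ^ (p ℕ.∸ 1) - y ^ (p ℕ.∸ 1)
    difference = trans (cong₂ _-_ (p*e₂ p∤x) (p*e₂ p∤y)) (cancel (x ^ (p ℕ.∸ 1)) (y ^ (p ℕ.∸ 1)))
      where
      cancel : ∀ X Y → (X - 1ℤ) - (Y - 1ℤ) ≡ X - Y
      cancel = solve-∀

  -- With y = x + p u and p ∤ u, one has e₂(y) ≡ e₂(x) + (p − 1) x^(p−2) u (mod p).
  e₂-separates : ∀ {x y} → + p ∤ x → y ≈ x [mod p ] → ¬ (y ≈ x [mod p ℕ.* p ]) → + p ∤ e x - e y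
  e₂-separates {x} {y} p∤x y≈x@(≈-mod (divides u y-x≡u*p)) y≉x =
    ∤-flip {x = e y} {y = e x} (∤-resp-≈ (≈-sym ey-ex≈c) p∤c)
    where
    k = p ℕ.∸ 2
    c = + suc k * x ^ k * u
    p∤u : + p ∤ u
    p∤u (divides v u≡v*p) = y≉x (≈-mod (divides v (begin
      y - x               ≡⟨ y-x≡u*p ⟩
      u * + p             ≡⟨ cong (_* + p) u≡v*p ⟩
      v * + p * + p       ≡⟨ ℤₚ.*-assoc v (+ p) (+ p) ⟩
      v * (+ p * + p)     ≡⟨ cong (v *_) (ℤₚ.pos-* p p) ⟨
      v * + (p ℕ.* p)     ∎)))
      where open ≡-Reasoning
    p∤1+k : + p ∤ + suc k
    p∤1+k p∣1+k = ℕₚ.<⇒≱ (subst (_< p) p-1≡1+[p-2] (ℕₚ.∸-monoʳ-< (s≤s z≤n) (ℕₚ.<⇒≤ 1<p)))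
                         (ℕ∣.∣⇒≤ (ℤ∣.∣⇒∣ᵤ p∣1+k))
    p∤c : + p ∤ c
    p∤c = ∤-* (∤-* p∤1+k (∤-^ k p∤x)) p∤u
    y≡x+p*u : y ≡ x + + p * u
    y≡x+p*u = trans (shift y x) (cong (_+_ x) (trans y-x≡u*p (ℤₚ.*-comm u (+ p))))
      where
      shift : ∀ y x → y ≡ x + (y - x)
      shift = solve-∀
    p*ey≈ : + p * e y ≈ + p * (e x + c) [mod p ℕ.* p ]
    p*ey≈ = begin
      + p * e y                                         ≡⟨ p*e₂ (∤-resp-≈ (≈-sym y≈x) p∤x) ⟩
      y ^ (p ℕ.∸ 1) - 1ℤ                                ≡⟨ cong₂ (λ z n → z ^ n - 1ℤ) y≡x+p*u p-1≡1+[p-2] ⟩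
      (x + + p * u) ^ suc k - 1ℤ                        ≈⟨ -‿cong-mod (binomial-mod² p k x u) (≈-refl {x = 1ℤ}) ⟩
      x ^ suc k + + suc k * x ^ k * (+ p * u) - 1ℤ      ≡⟨ cong (λ z → z + + suc k * x ^ k * (+ p * u) - 1ℤ) x^[1+k]≡ ⟩
      1ℤ + + p * e x + + suc k * x ^ k * (+ p * u) - 1ℤ ≡⟨ regroup (+ p) (e x) (+ suc k * x ^ k) u ⟩
      + p * (e x + c)                                   ∎
      where
      open ≈-Reasoning (p ℕ.* p)
      x^[1+k]≡ : x ^ suc k ≡ 1ℤ + + p * e x
      x^[1+k]≡ = trans (cong (x ^_) (sym p-1≡1+[p-2])) (x^[p-1]≡1+p*e₂ p∤x)
      regroup : ∀ P E K u → 1ℤ + P * E + K * (P * u) - 1ℤ ≡ P * (E + K * u)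
      regroup = solve-∀
    ey-ex≈c : e y - e x ≈ c [mod p ]
    ey-ex≈c = ≈-trans (-‿cong-mod (*-cancelˡ-≈ p p*ey≈) (≈-refl {x = e x})) (≈-reflexive (cancel (e x) c))
      where
      cancel : ∀ a c → a + c - a ≡ c
      cancel = solve-∀

  e₂-geometric : ∀ {x₀ ρ y} i → + p ∤ x₀ → + p ∤ ρ → y ≈ x₀ * ρ ^ i [mod p ℕ.* p ] →
                 e y ≈ e x₀ + + i * e ρ [mod p ]
  e₂-geometric {x₀} {ρ} {y} i p∤x₀ p∤ρ y≈ = begin
    e y                   ≈⟨ ≈-sym (e₂-cong (≈-sym y≈) (∤-* p∤x₀ (∤-^ i p∤ρ))) ⟩
    e (x₀ * ρ ^ i)        ≈⟨ e₂-* p∤x₀ (∤-^ i p∤ρ) ⟩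
    e x₀ + e (ρ ^ i)      ≈⟨ +-cong-mod (≈-refl {x = e x₀}) (e₂-^ p∤ρ i) ⟩
    e x₀ + + i * e ρ      ∎
    where open ≈-Reasoning p

-- Euler's totient and primitive roots

totCount-suc : ∀ m k → gcd (suc k) m ≡ 1 → totCount m (suc k) ≡ suc (totCount m k)
totCount-suc m k gcd≡1 with gcd (suc k) m ℕ.≟ 1
... | yes _    = refl
... | no gcd≢1 = ⊥-elim (gcd≢1 gcd≡1)

totCount-mono : ∀ m k → totCount m k ≤ totCount m (suc k)
totCount-mono m k with gcd (suc k) m ℕ.≟ 1
... | yes _ = ℕₚ.n≤1+n _
... | no  _ = ℕₚ.≤-refl

module _ {m d : ℕ} (coprime : ∀ k → ¬ d ℕ∣.∣ k → Coprime k m) where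

  totCount-block : ∀ q r → r < d → totCount m (q ℕ.* d) ℕ.+ r ≤ totCount m (q ℕ.* d ℕ.+ r)
  totCount-block q zero    _   =
    ℕₚ.≤-reflexive (trans (ℕₚ.+-identityʳ _) (cong (totCount m) (sym (ℕₚ.+-identityʳ (q ℕ.* d)))))
  totCount-block q (suc r) r<d = begin
    T (q ℕ.* d) ℕ.+ suc r       ≡⟨ ℕₚ.+-suc (T (q ℕ.* d)) r ⟩
    suc (T (q ℕ.* d) ℕ.+ r)     ≤⟨ s≤s (totCount-block q r (ℕₚ.<-trans (ℕₚ.n<1+n r) r<d)) ⟩
    suc (T (q ℕ.* d ℕ.+ r))     ≡⟨ totCount-suc m _ (Coprime.coprime⇒gcd≡1 (coprime _ d∤)) ⟨
    T (suc (q ℕ.* d ℕ.+ r))     ≡⟨ cong T (ℕₚ.+-suc (q ℕ.* d) r) ⟨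
    T (q ℕ.* d ℕ.+ suc r)       ∎
    where
    open ℕₚ.≤-Reasoning
    T = totCount m
    d∤ : ¬ d ℕ∣.∣ suc (q ℕ.* d ℕ.+ r)
    d∤ d∣ = ℕₚ.<⇒≱ r<d (ℕ∣.∣⇒≤ (ℕ∣.∣m+n∣m⇒∣n (subst (d ℕ∣.∣_) (sym (ℕₚ.+-suc (q ℕ.* d) r)) d∣)
                                              (ℕ∣.n∣m*n q)))

  totCount-multiples : 0 < d → ∀ q → q ℕ.* (d ℕ.∸ 1) ≤ totCount m (q ℕ.* d)
  totCount-multiples 0<d zero    = z≤n
  totCount-multiples 0<d (suc q) = begin
    (d ℕ.∸ 1) ℕ.+ q ℕ.* (d ℕ.∸ 1)        ≡⟨ ℕₚ.+-comm (d ℕ.∸ 1) _ ⟩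
    q ℕ.* (d ℕ.∸ 1) ℕ.+ (d ℕ.∸ 1)        ≤⟨ ℕₚ.+-monoˡ-≤ (d ℕ.∸ 1) (totCount-multiples 0<d q) ⟩
    T (q ℕ.* d) ℕ.+ (d ℕ.∸ 1)            ≤⟨ totCount-block q (d ℕ.∸ 1) d-1<d ⟩
    T (q ℕ.* d ℕ.+ (d ℕ.∸ 1))            ≤⟨ totCount-mono m _ ⟩
    T (suc (q ℕ.* d ℕ.+ (d ℕ.∸ 1)))      ≡⟨ cong T last-index ⟩
    T (d ℕ.+ q ℕ.* d)                    ∎
    where
    open ℕₚ.≤-Reasoning
    T = totCount m
    d-1<d : d ℕ.∸ 1 < d
    d-1<d = ℕₚ.∸-monoʳ-< (s≤s z≤n) 0<d
    last-index : suc (q ℕ.* d ℕ.+ (d ℕ.∸ 1)) ≡ d ℕ.+ q ℕ.* d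
    last-index = trans (sym (ℕₚ.+-suc (q ℕ.* d) (d ℕ.∸ 1)))
                       (trans (cong (q ℕ.* d ℕ.+_) (ℕₚ.m+[n∸m]≡n 0<d)) (ℕₚ.+-comm (q ℕ.* d) d))

powCong-normal : ∀ {m ρ} a {x} → PowCong m ρ a x →
                 Σ[ K ∈ ℕ ] Σ[ L ∈ ℕ ] (x * ρ ^ K ≈ ρ ^ L [mod m ]) × (a + + K ≡ + L)
powCong-normal {ρ = ρ} (+ n)    {x} x≡ρ^n =
  0 , n , ≈-trans (≈-reflexive (ℤₚ.*-identityʳ x)) (≡-mod⇒≈ x (ρ ^ n) x≡ρ^n) , ℤₚ.+-identityʳ (+ n)
powCong-normal {ρ = ρ} -[1+ n ] {x} xρ^n≡1 =
  suc n , 0 , ≡-mod⇒≈ (x * ρ ^ suc n) 1ℤ xρ^n≡1 , ℤₚ.+-inverseˡ (+ suc n)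

coprime-cancel : ∀ {m ρ} → Coprime m ℤ.∣ ρ ∣ → ∀ N {z} → + m ∣ z * ρ ^ N → + m ∣ z
coprime-cancel {m} {ρ} coprime zero    {z} m∣z*1 = subst (+ m ∣_) (ℤₚ.*-identityʳ z) m∣z*1
coprime-cancel {m} {ρ} coprime (suc N) {z} m∣zρρ^N =
  ℤ∣.∣ᵤ⇒∣ (Coprime.coprime-divisor coprime
    (subst (m ℕ∣.∣_) (trans (ℤₚ.abs-* z ρ) (ℕₚ.*-comm ℤ.∣ z ∣ ℤ.∣ ρ ∣))
      (ℤ∣.∣⇒∣ᵤ (coprime-cancel {ρ = ρ} coprime N {z * ρ}
        (subst (+ m ∣_) (sym (ℤₚ.*-assoc z ρ (ρ ^ N))) m∣zρρ^N)))))

powCong-ratio : ∀ {m ρ} → Coprime m ℤ.∣ ρ ∣ → ∀ a i {x y} →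
                PowCong m ρ a x → PowCong m ρ (a + + i) y → y ≈ x * ρ ^ i [mod m ]
powCong-ratio {m} {ρ} coprime a i {x} {y} x∼a y∼a+i
  with powCong-normal a x∼a | powCong-normal (a + + i) y∼a+i
... | K , L , xρ^K≈ρ^L , a+K≡L | K′ , L′ , yρ^K′≈ρ^L′ , a+i+K′≡L′ =
  ≈-mod (coprime-cancel coprime (K ℕ.+ K′) (subst (+ m ∣_) (sym factor) (∣-difference lhs≈rhs)))
  where
  exponents : L′ ℕ.+ K ≡ L ℕ.+ (i ℕ.+ K′)
  exponents = ℤₚ.+-injective (begin
    + (L′ ℕ.+ K)               ≡⟨ ℤₚ.pos-+ L′ K ⟩
    + L′ + + K                 ≡⟨ cong (_+ + K) a+i+K′≡L′ ⟨
    a + + i + + K′ + + K       ≡⟨ regroup a (+ i) (+ K) (+ K′) ⟩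
    (a + + K) + (+ i + + K′)   ≡⟨ cong₂ _+_ a+K≡L (sym (ℤₚ.pos-+ i K′)) ⟩
    + L + + (i ℕ.+ K′)         ≡⟨ ℤₚ.pos-+ L (i ℕ.+ K′) ⟨
    + (L ℕ.+ (i ℕ.+ K′))       ∎)
    where
    open ≡-Reasoning
    regroup : ∀ a i K K′ → a + i + K′ + K ≡ (a + K) + (i + K′)
    regroup = solve-∀
  lhs≈rhs : y * ρ ^ K′ * ρ ^ K ≈ x * ρ ^ K * (ρ ^ i * ρ ^ K′) [mod m ]
  lhs≈rhs = begin
    y * ρ ^ K′ * ρ ^ K               ≈⟨ *-cong-mod yρ^K′≈ρ^L′ (≈-refl {x = ρ ^ K}) ⟩
    ρ ^ L′ * ρ ^ K                   ≡⟨ ℤₚ.^-distribˡ-+-* ρ L′ K ⟨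
    ρ ^ (L′ ℕ.+ K)                   ≡⟨ cong (ρ ^_) exponents ⟩
    ρ ^ (L ℕ.+ (i ℕ.+ K′))           ≡⟨ ℤₚ.^-distribˡ-+-* ρ L (i ℕ.+ K′) ⟩
    ρ ^ L * ρ ^ (i ℕ.+ K′)           ≡⟨ cong (ρ ^ L *_) (ℤₚ.^-distribˡ-+-* ρ i K′) ⟩
    ρ ^ L * (ρ ^ i * ρ ^ K′)         ≈⟨ *-cong-mod (≈-sym xρ^K≈ρ^L) (≈-refl {x = ρ ^ i * ρ ^ K′}) ⟩
    x * ρ ^ K * (ρ ^ i * ρ ^ K′)     ∎
    where open ≈-Reasoning m
  factor : (y - x * ρ ^ i) * ρ ^ (K ℕ.+ K′) ≡ y * ρ ^ K′ * ρ ^ K - x * ρ ^ K * (ρ ^ i * ρ ^ K′)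
  factor = trans (cong ((y - x * ρ ^ i) *_) (ℤₚ.^-distribˡ-+-* ρ K K′)) (expand y x (ρ ^ i) (ρ ^ K) (ρ ^ K′))
    where
    expand : ∀ y x R A A′ → (y - x * R) * (A * A′) ≡ y * A′ * A - x * A * (R * A′)
    expand = solve-∀

powCong-relative : ∀ {m ρ x₀ y} → gcd ℤ.∣ ρ ∣ m ≡ 1 → ∀ a i →
                   PowCong m ρ (a + + 0) x₀ → PowCong m ρ (a + + i) y → y ≈ x₀ * ρ ^ i [mod m ]
powCong-relative {m} {ρ} {y = y} gcd≡1 a i x₀∼ y∼ =
  powCong-ratio (Coprime.sym (Coprime.gcd≡1⇒coprime gcd≡1)) (a + + 0) i x₀∼
                (subst (λ b → PowCong m ρ (b + + i) y) (sym (ℤₚ.+-identityʳ a)) y∼)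

module PrimitiveRoots {p : ℕ} (pp : Prime p) where

  open FermatQuotient pp

  ∤⇒coprime : ∀ {k} → ¬ p ℕ∣.∣ k → Coprime k p
  ∤⇒coprime p∤k (i∣k , i∣p) with prime⇒irreducible pp i∣p
  ... | inj₁ i≡1 = i≡1
  ... | inj₂ refl = ⊥-elim (p∤k i∣k)

  ∤⇒coprime-square : ∀ {k} → ¬ p ℕ∣.∣ k → Coprime k (p ℕ.* p)
  ∤⇒coprime-square p∤k (i∣k , i∣p*p) =
    ∤⇒coprime p∤k (i∣k , Coprime.coprime-divisor i-coprime-p i∣p*p)
    where
    i-coprime-p : Coprime _ p
    i-coprime-p (j∣i , j∣p) = ∤⇒coprime p∤k (ℕ∣.∣-trans j∣i i∣k , j∣p)

  p-1≤φ[p] : p ℕ.∸ 1 ≤ φ p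
  p-1≤φ[p] = subst (λ n → p ℕ.∸ 1 ≤ totCount p n) (ℕₚ.*-identityˡ p)
                   (subst (_≤ totCount p (1 ℕ.* p)) (ℕₚ.*-identityˡ (p ℕ.∸ 1))
                          (totCount-multiples (λ _ → ∤⇒coprime) (ℕₚ.<-trans (s≤s z≤n) 1<p) 1))

  p*[p-1]≤φ[p*p] : p ℕ.* (p ℕ.∸ 1) ≤ φ (p ℕ.* p)
  p*[p-1]≤φ[p*p] = totCount-multiples (λ _ → ∤⇒coprime-square) (ℕₚ.<-trans (s≤s z≤n) 1<p) p

  coprime⇒∤ : ∀ {m ρ} → gcd ℤ.∣ ρ ∣ m ≡ 1 → p ℕ∣.∣ m → + p ∤ ρ
  coprime⇒∤ gcd≡1 p∣m p∣ρ =
    ℕₚ.<⇒≢ 1<p (sym (ℕ∣.∣1⇒≡1 (subst (p ℕ∣.∣_) gcd≡1 (gcd-greatest (ℤ∣.∣⇒∣ᵤ p∣ρ) p∣m))))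

  ≈1⇒^p≈1 : ∀ {z} → z ≈ 1ℤ [mod p ] → z ^ p ≈ 1ℤ [mod p ℕ.* p ]
  ≈1⇒^p≈1 {z} (≈-mod (divides u z-1≡u*p)) = begin
    z ^ p                                                   ≡⟨ cong₂ _^_ z≡1+p*u p≡1+[p-1] ⟩
    (1ℤ + + p * u) ^ suc (p ℕ.∸ 1)                          ≈⟨ binomial-mod² p (p ℕ.∸ 1) 1ℤ u ⟩
    1ℤ ^ suc (p ℕ.∸ 1) + + suc (p ℕ.∸ 1) * 1ℤ ^ (p ℕ.∸ 1) * (+ p * u)
      ≡⟨ cong₂ (λ a b → a + + b * 1ℤ ^ (p ℕ.∸ 1) * (+ p * u)) (ℤₚ.^-zeroˡ (suc (p ℕ.∸ 1))) (sym p≡1+[p-1]) ⟩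
    1ℤ + + p * 1ℤ ^ (p ℕ.∸ 1) * (+ p * u)                   ≡⟨ cong (λ o → 1ℤ + + p * o * (+ p * u)) (ℤₚ.^-zeroˡ (p ℕ.∸ 1)) ⟩
    1ℤ + + p * 1ℤ * (+ p * u)                               ≈⟨ ≈-multiple² {p} u (regroup (+ p) u) ⟩
    1ℤ                                                      ∎
    where
    open ≈-Reasoning (p ℕ.* p)
    z≡1+p*u : z ≡ 1ℤ + + p * u
    z≡1+p*u = trans (shift z) (cong (_+_ 1ℤ) (trans z-1≡u*p (ℤₚ.*-comm u (+ p))))
      where
      shift : ∀ z → z ≡ 1ℤ + (z - 1ℤ)
      shift = solve-∀
    regroup : ∀ P u → 1ℤ + P * 1ℤ * (P * u) ≡ 1ℤ + u * (P * P)
    regroup = solve-∀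

  MaximalOrder : ℤ → Set
  MaximalOrder ρ = ∀ k → 1 ≤ k → k ≤ p ℕ.∸ 2 → ¬ (ρ ^ k ≈ 1ℤ [mod p ])

  ≤p-2⇒<p-1 : ∀ {k} → k ≤ p ℕ.∸ 2 → k < p ℕ.∸ 1
  ≤p-2⇒<p-1 {k} k≤p-2 = subst (k <_) (sym p-1≡1+[p-2]) (s≤s k≤p-2)

  primitiveRoot⇒maximalOrder : ∀ {ρ} → PrimitiveRoot p ρ → MaximalOrder ρ
  primitiveRoot⇒maximalOrder (_ , _ , minimal) k 1≤k k≤p-2 ρ^k≈1 =
    minimal k 1≤k (ℕₚ.<-≤-trans (≤p-2⇒<p-1 k≤p-2) p-1≤φ[p]) (≈⇒≡-mod ρ^k≈1)

  primitiveRoot²⇒maximalOrder : ∀ {ρ} → PrimitiveRoot (p ℕ.* p) ρ → MaximalOrder ρ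
  primitiveRoot²⇒maximalOrder {ρ} (_ , _ , minimal) k 1≤k k≤p-2 ρ^k≈1 =
    minimal (k ℕ.* p) (ℕₚ.*-mono-≤ 1≤k (ℕₚ.<⇒≤ 1<p)) k*p<φ
            (≈⇒≡-mod (subst (λ z → z ≈ 1ℤ [mod p ℕ.* p ]) (ℤₚ.^-*-assoc ρ k p) (≈1⇒^p≈1 ρ^k≈1)))
    where
    k*p<φ : k ℕ.* p < φ (p ℕ.* p)
    k*p<φ = ℕₚ.<-≤-trans (subst (k ℕ.* p <_) (ℕₚ.*-comm (p ℕ.∸ 1) p) (ℕₚ.*-monoˡ-< p (≤p-2⇒<p-1 k≤p-2)))
                         p*[p-1]≤φ[p*p]

  primitiveRoot²⇒∤e₂ : ∀ {ρ} → PrimitiveRoot (p ℕ.* p) ρ → + p ∤ e ρ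
  primitiveRoot²⇒∤e₂ {ρ} (gcd≡1 , _ , minimal) (divides v eρ≡v*p) =
    minimal (p ℕ.∸ 1) (subst (1 ≤_) (sym p-1≡1+[p-2]) (s≤s z≤n)) p-1<φ (≈⇒≡-mod (≈-multiple² {p} v (begin
      ρ ^ (p ℕ.∸ 1)                 ≡⟨ x^[p-1]≡1+p*e₂ (coprime⇒∤ gcd≡1 (ℕ∣.m∣m*n p)) ⟩
      1ℤ + + p * e ρ                ≡⟨ cong (λ z → 1ℤ + + p * z) eρ≡v*p ⟩
      1ℤ + + p * (v * + p)          ≡⟨ swap (+ p) v ⟩
      1ℤ + v * (+ p * + p)          ∎)))
    where
    open ≡-Reasoning
    swap : ∀ P v → 1ℤ + P * (v * P) ≡ 1ℤ + v * (P * P)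
    swap = solve-∀
    p-1<φ : p ℕ.∸ 1 < φ (p ℕ.* p)
    p-1<φ = ℕₚ.<-≤-trans (ℕₚ.∸-monoʳ-< (s≤s z≤n) (ℕₚ.<⇒≤ 1<p))
              (ℕₚ.≤-trans (ℕₚ.m≤m*n p (p ℕ.∸ 1) {{ℕ.>-nonZero (subst (0 <_) (sym p-1≡1+[p-2]) (s≤s z≤n))}}) p*[p-1]≤φ[p*p])

  maximalOrder⇒∤-powers-< : ∀ {ρ} → + p ∤ ρ → MaximalOrder ρ →
                            ∀ {a b} → a < b → b ≤ p ℕ.∸ 2 → + p ∤ ρ ^ b - ρ ^ a
  maximalOrder⇒∤-powers-< {ρ} p∤ρ order {a} {b} a<b b≤ p∣ρ^b-ρ^a
    with euclidsLemmaℤ (subst (+ p ∣_) factor p∣ρ^b-ρ^a)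
    where
    factor : ρ ^ b - ρ ^ a ≡ ρ ^ a * (ρ ^ (b ℕ.∸ a) - 1ℤ)
    factor = trans (cong (λ n → ρ ^ n - ρ ^ a) (sym (ℕₚ.m+[n∸m]≡n (ℕₚ.<⇒≤ a<b))))
                   (trans (cong (_- ρ ^ a) (ℤₚ.^-distribˡ-+-* ρ a (b ℕ.∸ a))) (expand (ρ ^ a) (ρ ^ (b ℕ.∸ a))))
      where
      expand : ∀ x y → x * y - x ≡ x * (y - 1ℤ)
      expand = solve-∀
  ... | inj₁ p∣ρ^a      = ∤-^ a p∤ρ p∣ρ^a
  ... | inj₂ p∣ρ^[b-a]-1 =
    order (b ℕ.∸ a) (ℕₚ.m<n⇒0<n∸m a<b) (ℕₚ.≤-trans (ℕₚ.m∸n≤m b a) b≤) (≈-mod p∣ρ^[b-a]-1)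

  maximalOrder⇒∤-powers : ∀ {ρ} → + p ∤ ρ → MaximalOrder ρ →
                          ∀ {a b} → a ≤ p ℕ.∸ 2 → b ≤ p ℕ.∸ 2 → a ≢ b → + p ∤ ρ ^ a - ρ ^ b
  maximalOrder⇒∤-powers {ρ} p∤ρ order {a} {b} a≤ b≤ a≢b with ℕₚ.<-cmp a b
  ... | tri< a<b _ _ = ∤-flip {x = ρ ^ b} {y = ρ ^ a} (maximalOrder⇒∤-powers-< p∤ρ order a<b b≤)
  ... | tri≈ _ a≡b _ = ⊥-elim (a≢b a≡b)
  ... | tri> _ _ b<a = maximalOrder⇒∤-powers-< p∤ρ order b<a a≤

  powCong-∤ : ∀ {m ρ a x} → p ℕ∣.∣ m → + p ∤ ρ → PowCong m ρ a x → + p ∤ x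
  powCong-∤ {ρ = ρ} {a} {x} p∣m p∤ρ x∼a p∣x with powCong-normal a x∼a
  ... | K , L , xρ^K≈ρ^L , _ = ∤-^ L p∤ρ (∣-resp-≈ (≈-mod-∣ p∣m xρ^K≈ρ^L) (ℤ∣.∣m⇒∣m*n (ρ ^ K) p∣x))

-- Confluent Vandermonde determinants

pow′ : ℤ → ℕ → ℤ
pow′ w zero    = 0ℤ
pow′ w (suc i) = + suc i * w ^ i

-- Column j holds the values of the functional f ↦ c_j f(w_j) + d_j f′(w_j) at f = Xⁱ.
confluentVandermonde : (c w d : ℕ → ℤ) → Matrix
confluentVandermonde c w d i j = c j * w j ^ i + d j * pow′ (w j) i

-- Row i + 1 minus v times row i evaluates the same functionals at (X − v) Xⁱ, that is,
-- it replaces the data (c , d) by (c (w − v) + d , d (w − v)).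
shiftValue : ℤ → (c w d : ℕ → ℤ) → ℕ → ℤ
shiftValue v c w d k = c k * (w k - v) + d k

shiftSlope : ℤ → (w d : ℕ → ℤ) → ℕ → ℤ
shiftSlope v w d k = d k * (w k - v)

confluentVandermonde-step : ∀ v c w d i j →
  confluentVandermonde c w d (suc i) j - v * confluentVandermonde c w d i j ≡
  confluentVandermonde (shiftValue v c w d) w (shiftSlope v w d) i j
confluentVandermonde-step v c w d zero    j = step₀ (c j) (w j) (d j) v
  where
  step₀ : ∀ c w d v → c * (w * 1ℤ) + d * (+ 1 * 1ℤ) - v * (c * 1ℤ + d * 0ℤ) ≡
                      (c * (w - v) + d) * 1ℤ + d * (w - v) * 0ℤ
  step₀ = solve-∀
confluentVandermonde-step v c w d (suc i) j = step (c j) (w j) (d j) v (w j ^ i) (+ suc i)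
  where
  step : ∀ c w d v W K → c * (w * (w * W)) + d * ((1ℤ + K) * (w * W)) - v * (c * (w * W) + d * (K * W)) ≡
                         (c * (w - v) + d) * (w * W) + d * (w - v) * (K * W)
  step = solve-∀

w*pow′ : ∀ w i → w * pow′ w i ≡ + i * w ^ i
w*pow′ w zero    = ℤₚ.*-zeroʳ w
w*pow′ w (suc i) = swap w (+ suc i) (w ^ i)
  where
  swap : ∀ w K X → w * (K * X) ≡ K * (w * X)
  swap = solve-∀

confluentVandermonde-splitℕ : ∀ t (c₁ c₂ w₁ w₂ d₁ d₂ : ℕ → ℤ) i j →
  confluentVandermonde (splitℕ t c₁ c₂) (splitℕ t w₁ w₂) (splitℕ t d₁ d₂) i j ≡
  splitℕ t (confluentVandermonde c₁ w₁ d₁ i) (confluentVandermonde c₂ w₂ d₂ i) j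
confluentVandermonde-splitℕ zero    c₁ c₂ w₁ w₂ d₁ d₂ i j       = refl
confluentVandermonde-splitℕ (suc t) c₁ c₂ w₁ w₂ d₁ d₂ i zero    = refl
confluentVandermonde-splitℕ (suc t) c₁ c₂ w₁ w₂ d₁ d₂ i (suc j) =
  confluentVandermonde-splitℕ t (c₁ ∘ suc) c₂ (w₁ ∘ suc) w₂ (d₁ ∘ suc) d₂ i j

detℕ-confluentVandermonde-pivot : ∀ {n} j (c w d : ℕ → ℤ) → j < suc n → d j ≡ 0ℤ →
  detℕ (suc n) (confluentVandermonde c w d) ≡
  sgn j * c j * detℕ n (confluentVandermonde (shiftValue (w j) c w d ∘ punch j) (w ∘ punch j) (shiftSlope (w j) w d ∘ punch j))
detℕ-confluentVandermonde-pivot {n} j c w d j<n dj≡0 = begin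
  detℕ (suc n) A                     ≡⟨ detℕ-addEarlierRows n 1 A B (λ _ → - v) ℕ.pred refl (λ { (suc i) _ → ℕₚ.n<1+n i }) B≗ B₀≗ ⟨
  detℕ (suc n) B                     ≡⟨ detℕ-pivot j B j<n column≡0 ⟩
  sgn j * B 0 j * detℕ n (minor j B) ≡⟨ cong (λ x → sgn j * x * detℕ n (minor j B)) top ⟩
  sgn j * c j * detℕ n (minor j B)   ∎
  where
  open ≡-Reasoning
  v = w j
  A B : Matrix
  A = confluentVandermonde c w d
  B zero    = A zero
  B (suc i) = confluentVandermonde (shiftValue v c w d) w (shiftSlope v w d) i
  B≗ : ∀ i → 1 ≤ i → B i ≗ (λ k → A i k + - v * A (ℕ.pred i) k)
  B≗ (suc i) _ k = trans (sym (confluentVandermonde-step v c w d i k)) (neg-mul (A (suc i) k) v (A i k))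
    where
    neg-mul : ∀ a v b → a - v * b ≡ a + - v * b
    neg-mul = solve-∀
  B₀≗ : ∀ i → i < 1 → B i ≗ A i
  B₀≗ zero _ _ = refl
  B₀≗ (suc i) (s≤s ())
  column≡0 : ∀ i → B (suc i) j ≡ 0ℤ
  column≡0 i rewrite dj≡0 = vanish (c j) (w j) (w j ^ i) (pow′ (w j) i)
    where
    vanish : ∀ c w W D → (c * (w - w) + 0ℤ) * W + 0ℤ * (w - w) * D ≡ 0ℤ
    vanish = solve-∀
  top : B 0 j ≡ c j
  top rewrite dj≡0 = trans (ℤₚ.+-identityʳ _) (ℤₚ.*-identityʳ (c j))

module _ {p : ℕ} (pp : Prime p) where

  open FermatQuotient pp

  private
    ∤-≡ : ∀ {x y} → x ≡ y → + p ∤ y → + p ∤ x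
    ∤-≡ refl p∤y = p∤y

    ∤-pivot : ∀ {n} j (c w d : ℕ → ℤ) → j < suc n → d j ≡ 0ℤ → + p ∤ c j →
      + p ∤ detℕ n (confluentVandermonde (shiftValue (w j) c w d ∘ punch j) (w ∘ punch j) (shiftSlope (w j) w d ∘ punch j)) →
      + p ∤ detℕ (suc n) (confluentVandermonde c w d)
    ∤-pivot j c w d j<n dj≡0 p∤cj p∤minor =
      ∤-≡ (detℕ-confluentVandermonde-pivot j c w d j<n dj≡0) (∤-* (∤-* (∤-sgn j) p∤cj) p∤minor)

  vandermonde-∤ : ∀ n (c w d : ℕ → ℤ) → (∀ k → k < n → d k ≡ 0ℤ) → (∀ k → k < n → + p ∤ c k) →
                  (∀ k l → k < n → l < n → k ≢ l → + p ∤ w k - w l) →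
                  + p ∤ detℕ n (confluentVandermonde c w d)
  vandermonde-∤ zero    c w d _   _   _      = ∤-abs1 refl
  vandermonde-∤ (suc n) c w d d≡0 p∤c p∤w-w =
    ∤-pivot {n} 0 c w d (s≤s z≤n) (d≡0 0 (s≤s z≤n)) (p∤c 0 (s≤s z≤n))
      (vandermonde-∤ n _ _ _
        (λ k k<n → trans (cong (_* (w (suc k) - w 0)) (d≡0 (suc k) (s≤s k<n))) (ℤₚ.*-zeroˡ (w (suc k) - w 0)))
        (λ k k<n → ∤-≡ (trans (cong (_+_ (c (suc k) * (w (suc k) - w 0))) (d≡0 (suc k) (s≤s k<n))) (ℤₚ.+-identityʳ _))
                       (∤-* (p∤c (suc k) (s≤s k<n)) (p∤w-w (suc k) 0 (s≤s k<n) (s≤s z≤n) (λ ()))))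
        (λ k l k<n l<n k≢l → p∤w-w (suc k) (suc l) (s≤s k<n) (s≤s l<n) (k≢l ∘ ℕₚ.suc-injective)))

  -- The node w₀ is eliminated twice: first its value column, then its derivative column,
  -- which the first elimination has turned into a value column whose coefficient is its slope.
  confluentVandermonde-∤ : ∀ t (c w d : ℕ → ℤ) →
    (∀ k → k < t → d k ≡ 0ℤ) → (∀ k → k < t → + p ∤ c k) →
    (∀ k → k < t → w (t ℕ.+ k) ≡ w k) → (∀ k → k < t → + p ∤ d (t ℕ.+ k)) →
    (∀ k l → k < t → l < t → k ≢ l → + p ∤ w k - w l) →
    + p ∤ detℕ (t ℕ.+ t) (confluentVandermonde c w d)
  confluentVandermonde-∤ zero    c w d _   _   _  _   _      = ∤-abs1 refl
  confluentVandermonde-∤ (suc t) c w d d≡0 p∤c w≡ p∤d p∤w-w =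
    ∤-pivot {t ℕ.+ suc t} 0 c w d (s≤s z≤n) (d≡0 0 (s≤s z≤n)) (p∤c 0 (s≤s z≤n))
      (subst (λ n → + p ∤ detℕ n (confluentVandermonde c₁ w₁ d₁)) (sym (ℕₚ.+-suc t t))
        (∤-pivot {t ℕ.+ t} t c₁ w₁ d₁ (s≤s (ℕₚ.m≤m+n t t)) d₁t≡0 p∤c₁t
          (confluentVandermonde-∤ t c₂ w₂ d₂ d₂≡0 p∤c₂ w₂≡ p∤d₂ p∤w₂-w₂)))
    where
    c₁ w₁ d₁ c₂ w₂ d₂ : ℕ → ℤ
    c₁ = shiftValue (w 0) c w d ∘ suc
    w₁ = w ∘ suc
    d₁ = shiftSlope (w 0) w d ∘ suc
    c₂ = shiftValue (w₁ t) c₁ w₁ d₁ ∘ punch t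
    w₂ = w₁ ∘ punch t
    d₂ = shiftSlope (w₁ t) w₁ d₁ ∘ punch t
    w₁t≡w₀ : w₁ t ≡ w 0
    w₁t≡w₀ = trans (cong (w ∘ suc) (sym (ℕₚ.+-identityʳ t))) (w≡ 0 (s≤s z≤n))
    p∤w-w₀ : ∀ k → k < t → + p ∤ w₁ k - w 0
    p∤w-w₀ k k<t = p∤w-w (suc k) 0 (s≤s k<t) (s≤s z≤n) (λ ())
    d₁t≡0 : d₁ t ≡ 0ℤ
    d₁t≡0 = trans (cong (λ z → d (suc t) * (z - w 0)) w₁t≡w₀) (vanish (d (suc t)) (w 0))
      where
      vanish : ∀ d w → d * (w - w) ≡ 0ℤ
      vanish = solve-∀
    p∤c₁t : + p ∤ c₁ t
    p∤c₁t = ∤-≡ (trans (cong (λ z → c (suc t) * (z - w 0) + d (suc t)) w₁t≡w₀) (vanish (c (suc t)) (w 0) (d (suc t))))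
                (∤-≡ (cong (d ∘ suc) (sym (ℕₚ.+-identityʳ t))) (p∤d 0 (s≤s z≤n)))
      where
      vanish : ∀ c w d → c * (w - w) + d ≡ d
      vanish = solve-∀
    d₂≡0 : ∀ k → k < t → d₂ k ≡ 0ℤ
    d₂≡0 k k<t rewrite punch-below k<t | d≡0 (suc k) (s≤s k<t) = vanish (w₁ k - w 0) (w₁ k - w₁ t)
      where
      vanish : ∀ a b → 0ℤ * a * b ≡ 0ℤ
      vanish = solve-∀
    p∤c₂ : ∀ k → k < t → + p ∤ c₂ k
    p∤c₂ k k<t rewrite punch-below k<t | d≡0 (suc k) (s≤s k<t) | w₁t≡w₀ =
      ∤-≡ (square (c (suc k)) (w₁ k - w 0))
          (∤-* (∤-* (p∤c (suc k) (s≤s k<t)) (p∤w-w₀ k k<t)) (p∤w-w₀ k k<t))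
      where
      square : ∀ c x → (c * x + 0ℤ) * x + 0ℤ * x ≡ c * x * x
      square = solve-∀
    w₁[1+t+r]≡ : ∀ r → r < t → w₁ (suc (t ℕ.+ r)) ≡ w₁ r
    w₁[1+t+r]≡ r r<t = trans (cong (w ∘ suc) (sym (ℕₚ.+-suc t r))) (w≡ (suc r) (s≤s r<t))
    w₂≡ : ∀ r → r < t → w₂ (t ℕ.+ r) ≡ w₂ r
    w₂≡ r r<t rewrite punch-above (ℕₚ.m≤m+n t r) | punch-below r<t = w₁[1+t+r]≡ r r<t
    p∤d₂ : ∀ r → r < t → + p ∤ d₂ (t ℕ.+ r)
    p∤d₂ r r<t rewrite punch-above (ℕₚ.m≤m+n t r) | w₁[1+t+r]≡ r r<t | w₁t≡w₀ =
      ∤-* (∤-* (∤-≡ (cong (d ∘ suc) (sym (ℕₚ.+-suc t r))) (p∤d (suc r) (s≤s r<t))) (p∤w-w₀ r r<t))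
          (p∤w-w₀ r r<t)
    p∤w₂-w₂ : ∀ k l → k < t → l < t → k ≢ l → + p ∤ w₂ k - w₂ l
    p∤w₂-w₂ k l k<t l<t k≢l rewrite punch-below k<t | punch-below l<t =
      p∤w-w (suc k) (suc l) (s≤s k<t) (s≤s l<t) (k≢l ∘ ℕₚ.suc-injective)

-- Good starting sets

stacked : ℕ → Matrix → (ℕ → ℤ) → (ℕ → ℤ) → Matrix
stacked t P f g = splitℕ t (λ s → splitℕ t (P s) (λ k → f s * P s k)) (λ s → splitℕ t (P s) (λ k → g s * P s k))

detℕ-stacked : ∀ t (P : Matrix) (f g : ℕ → ℤ) →
               detℕ (t ℕ.+ t) (stacked t P f g) ≡ sgn (t ℕ.* t) * (∏ℕ t (λ s → f s - g s) * detℕ t P * detℕ t P)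
detℕ-stacked t P f g = begin
  detℕ (t ℕ.+ t) (stacked t P f g)
    ≡⟨ detℕ-addLaterRows t (stacked t P f g) B (λ _ → -1ℤ) (t ℕ.+_)
                         (λ i i<t → ℕₚ.m<n+m i (ℕₚ.≤-<-trans z≤n i<t) , ℕₚ.+-monoʳ-< t i<t) (ℕₚ.m≤m+n t t)
                         subtract-lower (λ i t≤i → cong-app (splitℕ-≥ t reduced upper lower t≤i)) ⟨
  detℕ (t ℕ.+ t) B
    ≡⟨ detℕ-antiBlock t t B (λ i j i<t j<t → trans (cong-app (splitℕ-< t reduced lower i<t) j)
                                                   (splitℕ-< t (λ _ → 0ℤ) (λ k → δ i * P i k) j<t)) ⟩
  sgn (t ℕ.* t) * (detℕ t (λ i l → B i (t ℕ.+ l)) * detℕ t (λ i j → B (t ℕ.+ i) j))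
    ≡⟨ cong₂ (λ u v → sgn (t ℕ.* t) * (u * v))
             (trans (detℕ-cong t (λ i l i<t _ → trans (cong-app (splitℕ-< t reduced lower i<t) (t ℕ.+ l))
                                                      (splitℕ-+ t (λ _ → 0ℤ) (λ k → δ i * P i k) l)))
                    (detℕ-scaleRows t δ P))
             (detℕ-cong t (λ i j _ j<t → trans (cong-app (splitℕ-+ t reduced lower i) j)
                                               (splitℕ-< t (P i) (λ k → g i * P i k) j<t))) ⟩
  sgn (t ℕ.* t) * (∏ℕ t δ * detℕ t P * detℕ t P) ∎
  where
  open ≡-Reasoning
  δ : ℕ → ℤ
  δ s = f s - g s
  upper lower reduced : ℕ → ℕ → ℤ
  upper s   = splitℕ t (P s) (λ k → f s * P s k)
  lower s   = splitℕ t (P s) (λ k → g s * P s k)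
  reduced s = splitℕ t (λ _ → 0ℤ) (λ k → δ s * P s k)
  B : Matrix
  B = splitℕ t reduced lower
  subtract-lower : ∀ i → i < t → B i ≗ (λ j → stacked t P f g i j + -1ℤ * stacked t P f g (t ℕ.+ i) j)
  subtract-lower i i<t j = begin
    B i j
      ≡⟨ cong-app (splitℕ-< t reduced lower i<t) j ⟩
    splitℕ t (λ _ → 0ℤ) (λ k → δ i * P i k) j
      ≡⟨ splitℕ-cong t (λ k → sym (cancel (P i k))) (λ k → distribute (f i) (g i) (P i k)) j ⟩
    splitℕ t (λ k → P i k + -1ℤ * P i k) (λ k → f i * P i k + -1ℤ * (g i * P i k)) j
      ≡⟨ splitℕ-zipWith (λ u v → u + -1ℤ * v) t (P i) (λ k → f i * P i k) (P i) (λ k → g i * P i k) j ⟨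
    upper i j + -1ℤ * lower i j
      ≡⟨ cong₂ (λ u v → u j + -1ℤ * v j) (splitℕ-< t upper lower i<t) (splitℕ-+ t upper lower i) ⟨
    stacked t P f g i j + -1ℤ * stacked t P f g (t ℕ.+ i) j ∎
    where
    cancel : ∀ z → z + -1ℤ * z ≡ 0ℤ
    cancel = solve-∀
    distribute : ∀ a b z → (a - b) * z ≡ a * z + -1ℤ * (b * z)
    distribute = solve-∀

module GeometricRows {p : ℕ} (pp : Prime p) {t : ℕ} (α : Fin t → ℕ) (x₀ ρ : ℤ) where

  open FermatQuotient pp
  open PrimitiveRoots pp

  αℕ : ℕ → ℕ
  αℕ = extend 0 α

  C W : ℕ → ℤ
  C k = x₀ ^ αℕ k
  W k = ρ ^ αℕ k

  P : ℕ → ℕ → ℤ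
  P s k = C k * W k ^ s

  goodMatrix-row : ∀ (x : Fin (t ℕ.+ t) → ℤ) i s E → x i ≈ x₀ * ρ ^ s [mod p ] → e (x i) ≈ E [mod p ] →
                   ∀ j → goodMatrix p pp t x α i j ≈ splitℕ t (P s) (λ k → E * P s k) (toℕ j) [mod p ]
  goodMatrix-row x i s E xᵢ≈ eᵢ≈ =
    [,]-splitAt≈splitℕ t _ _ (P s) (λ k → E * P s k) power (λ k → *-cong-mod eᵢ≈ (power k))
    where
    power : ∀ k → x i ^ α k ≈ P s (toℕ k) [mod p ]
    power k = begin
      x i ^ α k                      ≈⟨ ^-cong-mod (α k) xᵢ≈ ⟩
      (x₀ * ρ ^ s) ^ α k             ≡⟨ ^-distrib-* x₀ (ρ ^ s) (α k) ⟩
      x₀ ^ α k * (ρ ^ s) ^ α k       ≡⟨ cong (x₀ ^ α k *_) (^-^-comm ρ s (α k)) ⟩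
      x₀ ^ α k * (ρ ^ α k) ^ s       ≡⟨ cong (λ a → x₀ ^ a * (ρ ^ a) ^ s) (extend-toℕ 0 α k) ⟨
      P s (toℕ k)                    ∎
      where open ≈-Reasoning p

  -- Modulo p the right block of the matrix is E₀ times the left block plus c₀ C_k W_k
  -- times the derivative i W_k^(i−1): this is a confluent Vandermonde matrix.
  confluentModel : ℤ → ℤ → Matrix
  confluentModel E₀ c₀ = confluentVandermonde (splitℕ t C (λ k → E₀ * C k)) (splitℕ t W W)
                                              (splitℕ t (λ _ → 0ℤ) (λ k → c₀ * C k * W k))

  confluentModel-row : ∀ E₀ c₀ s j → splitℕ t (P s) (λ k → (E₀ + + s * c₀) * P s k) j ≡ confluentModel E₀ c₀ s j
  confluentModel-row E₀ c₀ s j =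
    trans (splitℕ-cong t (λ k → sym (ℤₚ.+-identityʳ (P s k))) derivative j)
          (sym (confluentVandermonde-splitℕ t C (λ k → E₀ * C k) W W (λ _ → 0ℤ) (λ k → c₀ * C k * W k) s j))
    where
    derivative : ∀ k → (E₀ + + s * c₀) * P s k ≡ E₀ * C k * W k ^ s + c₀ * C k * W k * pow′ (W k) s
    derivative k = trans (expand E₀ (+ s) c₀ (C k) (W k ^ s))
                         (trans (cong (λ z → E₀ * C k * W k ^ s + c₀ * C k * z) (sym (w*pow′ (W k) s)))
                                (cong (_+_ (E₀ * C k * W k ^ s)) (sym (ℤₚ.*-assoc (c₀ * C k) (W k) (pow′ (W k) s)))))
      where
      expand : ∀ E s c C X → (E + s * c) * (C * X) ≡ E * C * X + c * C * (s * X)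
      expand = solve-∀

  module _ (p∤x₀ : + p ∤ x₀) (p∤ρ : + p ∤ ρ) (order : MaximalOrder ρ)
           (α-injective : Injective _≡_ _≡_ α) (α≤ : ∀ k → α k ≤ p ℕ.∸ 2) where

    p∤C : ∀ k → + p ∤ C k
    p∤C k = ∤-^ (αℕ k) p∤x₀

    p∤W-W : ∀ k l → k < t → l < t → k ≢ l → + p ∤ W k - W l
    p∤W-W k l k<t l<t k≢l =
      maximalOrder⇒∤-powers p∤ρ order (bound k<t) (bound l<t) (k≢l ∘ extend-injective 0 α-injective k<t l<t)
      where
      bound : ∀ {k} → k < t → αℕ k ≤ p ℕ.∸ 2
      bound k<t = subst (_≤ p ℕ.∸ 2) (sym (extend-fromℕ< 0 α k<t)) (α≤ _)

    p∤det-P : + p ∤ detℕ t P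
    p∤det-P = subst (λ z → + p ∤ z) (detℕ-cong t (λ s k _ _ → ℤₚ.+-identityʳ (P s k)))
                (vandermonde-∤ pp t C W (λ _ → 0ℤ) (λ _ _ → refl) (λ k _ → p∤C k) p∤W-W)

    p∤det-confluentModel : ∀ E₀ {c₀} → + p ∤ c₀ → + p ∤ detℕ (t ℕ.+ t) (confluentModel E₀ c₀)
    p∤det-confluentModel E₀ {c₀} p∤c₀ = confluentVandermonde-∤ pp t _ _ _
      (λ k k<t → splitℕ-< t (λ _ → 0ℤ) (λ k → c₀ * C k * W k) k<t)
      (λ k k<t → subst (λ z → + p ∤ z) (sym (splitℕ-< t C (λ k → E₀ * C k) k<t)) (p∤C k))
      (λ k k<t → trans (splitℕ-+ t W W k) (sym (splitℕ-< t W W k<t)))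
      (λ k k<t → subst (λ z → + p ∤ z) (sym (splitℕ-+ t (λ _ → 0ℤ) (λ k → c₀ * C k * W k) k))
                       (∤-* (∤-* p∤c₀ (p∤C k)) (∤-^ (αℕ k) p∤ρ)))
      (λ k l k<t l<t k≢l → subst (λ z → + p ∤ z) (sym (cong₂ _-_ (splitℕ-< t W W k<t) (splitℕ-< t W W l<t)))
                                 (p∤W-W k l k<t l<t k≢l))

module _ {p : ℕ} (pp : Prime p) where

  open FermatQuotient pp
  open PrimitiveRoots pp

  goodStartingSet-p² : ∀ t (ρ a : ℤ) (x : Fin (suc t ℕ.+ suc t) → ℤ) → PrimitiveRoot (p ℕ.* p) ρ →
                       (∀ i → PowCong (p ℕ.* p) ρ (a + + toℕ i) (x i)) → GoodStartingSet p pp (suc t) x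
  goodStartingSet-p² t ρ a x prim@(gcd≡1 , _ , _) x∼ α α-injective α≤ det≡0 =
    p∤det-confluentModel p∤x₀ p∤ρ (primitiveRoot²⇒maximalOrder prim) α-injective α≤
                         (e x₀) (primitiveRoot²⇒∤e₂ prim)
      (∣-resp-≈ (det≈detℕ (T ℕ.+ T) _ (confluentModel (e x₀) (e ρ)) entries) (≈0⇒∣ (≡-mod⇒≈ _ 0ℤ det≡0)))
    where
    T = suc t
    x₀ = x zero
    open GeometricRows pp α x₀ ρ
    p∤ρ : + p ∤ ρ
    p∤ρ = coprime⇒∤ gcd≡1 (ℕ∣.m∣m*n p)
    p∤x₀ : + p ∤ x₀
    p∤x₀ = powCong-∤ (ℕ∣.m∣m*n p) p∤ρ (x∼ zero)
    x≈ : ∀ i → x i ≈ x₀ * ρ ^ toℕ i [mod p ℕ.* p ]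
    x≈ i = powCong-relative gcd≡1 a (toℕ i) (x∼ zero) (x∼ i)
    entries : ∀ i j → goodMatrix p pp T x α i j ≈ confluentModel (e x₀) (e ρ) (toℕ i) (toℕ j) [mod p ]
    entries i j = ≈-trans (goodMatrix-row x i (toℕ i) _ (≈-mod-∣ (ℕ∣.m∣m*n p) (x≈ i))
                                          (e₂-geometric (toℕ i) p∤x₀ p∤ρ (x≈ i)) j)
                          (≈-reflexive (confluentModel-row (e x₀) (e ρ) (toℕ i) (toℕ j)))

  goodStartingSet-p : ∀ t (ρ a : ℤ) (x : Fin (suc t ℕ.+ suc t) → ℤ) → PrimitiveRoot p ρ →
    (∀ (i : Fin (suc t)) → PowCong p ρ (a + + toℕ i) (x (i ↑ˡ suc t)) × PowCong p ρ (a + + toℕ i) (x (suc t ↑ʳ i))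
                         × ¬ (x (suc t ↑ʳ i) ≡ x (i ↑ˡ suc t) [mod p ℕ.* p ])) →
    GoodStartingSet p pp (suc t) x
  goodStartingSet-p t ρ a x prim@(gcd≡1 , _ , _) x∼ α α-injective α≤ det≡0 =
    p∤det-stacked (∣-resp-≈ (det≈detℕ (T ℕ.+ T) _ N entries) (≈0⇒∣ (≡-mod⇒≈ _ 0ℤ det≡0)))
    where
    T = suc t
    x₀ = x zero
    open GeometricRows pp α x₀ ρ
    upper lower : Fin T → ℤ
    upper k = x (k ↑ˡ T)
    lower k = x (T ↑ʳ k)
    p∤ρ : + p ∤ ρ
    p∤ρ = coprime⇒∤ gcd≡1 ℕ∣.∣-refl
    upper≈ lower≈ : ∀ k → _ ≈ x₀ * ρ ^ toℕ k [mod p ]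
    upper≈ k = powCong-relative gcd≡1 a (toℕ k) (proj₁ (x∼ zero)) (proj₁ (x∼ k))
    lower≈ k = powCong-relative gcd≡1 a (toℕ k) (proj₁ (x∼ zero)) (proj₁ (proj₂ (x∼ k)))
    eU eL : ℕ → ℤ
    eU = extend 0ℤ (e ∘ upper)
    eL = extend 0ℤ (e ∘ lower)
    upperRow lowerRow : ℕ → ℕ → ℤ
    upperRow s = splitℕ T (P s) (λ k → eU s * P s k)
    lowerRow s = splitℕ T (P s) (λ k → eL s * P s k)
    N : Matrix
    N = stacked T P eU eL
    entries : ∀ i j → goodMatrix p pp T x α i j ≈ N (toℕ i) (toℕ j) [mod p ]
    entries i j with splitView T i
    ... | left k  = ≈-trans (goodMatrix-row x (k ↑ˡ T) (toℕ k) (eU (toℕ k)) (upper≈ k)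
                                            (≈-reflexive (sym (extend-toℕ 0ℤ (e ∘ upper) k))) j)
                            (≈-reflexive (sym (trans (cong (λ s → N s (toℕ j)) (Finₚ.toℕ-↑ˡ k T))
                                                     (cong-app (splitℕ-< T upperRow lowerRow (Finₚ.toℕ<n k)) (toℕ j)))))
    ... | right k = ≈-trans (goodMatrix-row x (T ↑ʳ k) (toℕ k) (eL (toℕ k)) (lower≈ k)
                                            (≈-reflexive (sym (extend-toℕ 0ℤ (e ∘ lower) k))) j)
                            (≈-reflexive (sym (trans (cong (λ s → N s (toℕ j)) (Finₚ.toℕ-↑ʳ T k))
                                                     (cong-app (splitℕ-+ T upperRow lowerRow (toℕ k)) (toℕ j)))))
    p∤eU-eL : ∀ i → i < T → + p ∤ eU i - eL i
    p∤eU-eL i i<T = subst (λ z → + p ∤ z)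
                          (sym (cong₂ _-_ (extend-fromℕ< 0ℤ (e ∘ upper) i<T) (extend-fromℕ< 0ℤ (e ∘ lower) i<T)))
                      (e₂-separates (powCong-∤ ℕ∣.∣-refl p∤ρ (proj₁ (x∼ k))) (≈-trans (lower≈ k) (≈-sym (upper≈ k)))
                                    (proj₂ (proj₂ (x∼ k)) ∘ ≈⇒≡-mod))
      where
      k = fromℕ< i<T
    p∤det-stacked : + p ∤ detℕ (T ℕ.+ T) N
    p∤det-stacked = subst (λ z → + p ∤ z) (sym (detℕ-stacked T P eU eL))
                      (∤-* (∤-sgn (T ℕ.* T)) (∤-* (∤-* (∤-∏ℕ T p∤eU-eL) p∤det-P′) p∤det-P′))
      where
      p∤det-P′ = p∤det-P (powCong-∤ ℕ∣.∣-refl p∤ρ (proj₁ (x∼ zero))) p∤ρ (primitiveRoot⇒maximalOrder prim)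
                         α-injective α≤

proposition1p14 : (p : ℕ) (pp : Prime p) → p ≢ 2 → (t : ℕ) → 1 ≤ t → t ≤ p ∸ 1 →
    ((ρ a : ℤ) (x : Fin (t +ℕ t) → ℤ) → PrimitiveRoot (p *ℕ p) ρ →
       (∀ i → PowCong (p *ℕ p) ρ (a + + toℕ i) (x i)) →
       GoodStartingSet p pp t x)
    ×
    ((ρ a : ℤ) (x : Fin (t +ℕ t) → ℤ) → PrimitiveRoot p ρ →
       (∀ (i : Fin t) → PowCong p ρ (a + + toℕ i) (x (i ↑ˡ t))
                      × PowCong p ρ (a + + toℕ i) (x (t ↑ʳ i))
                      × ¬ (x (t ↑ʳ i) ≡ x (i ↑ˡ t) [mod p *ℕ p ])) →
       GoodStartingSet p pp t x)
proposition1p14 p pp _ (suc t) _ _ = goodStartingSet-p² pp t , goodStartingSet-p pp t
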